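{- Let $t\ge 2$ be a real number, let $G$ be a $t$-tough $(P_{3}\cup 3P_{1})$-free graph, let $S$ be a cutset of $G$, and let $s=\lfloor t/2\rfloor$. If $w(G-S)\ge 5$, then $G$ has a generalized $K_{1,2s}$-matching centered at the components of $G-S$.
   Context: All graphs are finite and simple. A cutset of $G$ is a set $S\subseteq V(G)$ with $G-S$ disconnected; $w(G-S)$ is the number of components of $G-S$. $G$ is $t$-tough if $|S|\ge t\cdot w(G-S)$ for every cutset $S$. $R$-free means no induced copy of $R$; $P_{3}\cup 3P_{1}$ is the disjoint union of a path on three vertices and three isolated vertices. For $X\subseteq V(G)$, $N_G(X)$ is the set of vertices outside $X$ adjacent to some vertex of $X$. For a nonempty $X\subseteq V(G)$, $Y\subseteq N_G(X)$ and an integer $s\ge1$, $G[X,Y]$ is a generalized $K_{1,2s}$ with center $X$ if $|Y|=2s$ and, when $|X|\ge 2$, there exist partitions $\{X_1,X_2\}$ of $X$ and $\{Y_1,Y_2\}$ of $Y$ with $Y_i\subseteq N_G(X_i)\cap Y$ and $|Y_i|=s$ for $i=1,2$. If $S$ is a cutset and $D_1,\dots,D_\ell$ ($\ell\ge2$) are the components of $G-S$, then $G$ has a generalized $K_{1,2s}$-matching centered at the components of $G-S$ if for every $i\in[1,\ell]$ there is $S_i\subseteq N_G(D_i)\cap S$ such that $G[V(D_i),S_i]$ is a generalized $K_{1,2s}$ with center $V(D_i)$, and $S_i\cap S_j=\emptyset$ for all distinct $i,j$.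
   Formalization: The toughness parameter t ranges over the rationals rather than the real numbers. -}

module Defs where

open import Data.Bool using (Bool; true; false)
open import Data.Nat using (ℕ; _≤_)
open import Data.Integer using (+_)
open import Data.Rational using (ℚ; _/_; _*_; ½)
import Data.Rational as ℚ
open import Data.Fin using (Fin; zero; suc)
open import Data.Fin.Subset using (Subset; _∈_; _∉_; _⊆_; _∪_; _∩_; ∁; ∣_∣; Nonempty; ⊥)
open import Data.List using (List; length; lookup)
open import Data.List.Relation.Unary.All using (All)
open import Data.List.Relation.Unary.Unique.Propositional using (Unique)
import Data.List.Membership.Propositional as LM
open import Data.Product using (Σ; ∃; _×_)
open import Relation.Binary.PropositionalEquality using (_≡_; _≢_)
open import Relation.Nullary using (¬_)
open import Function.Definitions using (Injective)

record Graph : Set where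
  field
    n      : ℕ
    adj    : Fin n → Fin n → Bool
    sym    : ∀ u v → adj u v ≡ adj v u
    irrefl : ∀ u → adj u u ≡ false
open Graph public

module _ (G : Graph) where
  V : Set
  V = Fin (n G)

  VSet : Set
  VSet = Subset (n G)

  -- walks whose vertices (after the start) lie in D
  data Reach (D : VSet) : V → V → Set where
    here : ∀ {u} → Reach D u u
    step : ∀ {u x v} → adj G u x ≡ true → x ∈ D → Reach D x v → Reach D u v

  Connected : VSet → Set
  Connected D = ∀ u v → u ∈ D → v ∈ D → Reach D u v

  Cutset : VSet → Set
  Cutset S = Σ V λ u → Σ V λ v → u ∉ S × v ∉ S × ¬ Reach (∁ S) u v

  Component : VSet → VSet → Set
  Component S D = Nonempty D × D ⊆ ∁ S × Connected D
                × (∀ u v → u ∈ D → v ∉ S → v ∉ D → adj G u v ≡ false)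

  ComponentList : VSet → List VSet → Set
  ComponentList S Ds = Unique Ds × All (Component S) Ds
                     × (∀ D → Component S D → D LM.∈ Ds)

  -- w(G - S) = length Ds; G is t-tough
  Tough : ℚ → Set
  Tough t = ∀ S Ds → Cutset S → ComponentList S Ds
          → t * (+ length Ds / 1) ℚ.≤ (+ ∣ S ∣ / 1)

  InN : VSet → V → Set
  InN X v = v ∉ X × ∃ λ u → u ∈ X × adj G u v ≡ true

  NbhdSub : VSet → VSet → Set
  NbhdSub Y X = ∀ v → v ∈ Y → InN X v

  Partition2 : VSet → VSet → VSet → Set
  Partition2 A A1 A2 = Nonempty A1 × Nonempty A2 × A1 ∩ A2 ≡ ⊥ × A1 ∪ A2 ≡ A

  GenK : ℕ → VSet → VSet → Set
  GenK s X Y = Nonempty X × NbhdSub Y X × ∣ Y ∣ ≡ s Data.Nat.+ s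
             × (2 ≤ ∣ X ∣ → Σ VSet λ X1 → Σ VSet λ X2 → Σ VSet λ Y1 → Σ VSet λ Y2 →
                  Partition2 X X1 X2 × Partition2 Y Y1 Y2
                  × NbhdSub Y1 X1 × Y1 ⊆ Y × ∣ Y1 ∣ ≡ s
                  × NbhdSub Y2 X2 × Y2 ⊆ Y × ∣ Y2 ∣ ≡ s)

  GenKMatching : ℕ → VSet → List VSet → Set
  GenKMatching s S Ds = Σ (Fin (length Ds) → VSet) λ Ss →
      (∀ i → NbhdSub (Ss i) (lookup Ds i) × Ss i ⊆ S × GenK s (lookup Ds i) (Ss i))
    × (∀ i j → i ≢ j → Ss i ∩ Ss j ≡ ⊥)

  HasInduced : {k : ℕ} → (Fin k → Fin k → Bool) → Set
  HasInduced {k} R = Σ (Fin k → V) λ f → Injective _≡_ _≡_ f × (∀ i j → adj G (f i) (f j) ≡ R i j)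

P3∪3P1 : Fin 6 → Fin 6 → Bool
P3∪3P1 zero (suc zero) = true
P3∪3P1 (suc zero) zero = true
P3∪3P1 (suc zero) (suc (suc zero)) = true
P3∪3P1 (suc (suc zero)) (suc zero) = true
P3∪3P1 _ _ = false

Free : Graph → {k : ℕ} → (Fin k → Fin k → Bool) → Set
Free G R = ¬ HasInduced G R

-- Every vertex outside S gets a demand: s for each of two centres u, w of its component of G - S (2s when
-- the component is a single vertex and u = w) and 1 for every other vertex. A demand is served by
-- neighbours in S or, as placeholders, by non-centres of the vertex's own component. Hall's condition for
-- this system comes from toughness: for a set Q, deleting the S-neighbours of Q together with the rest of
-- the components of G - S met by Q leaves each of these components contributing a component of G - S* of
-- its own, so 2s times their number is at most |S*|, and that pays for the demand of Q. In each component
-- at least 2s units are then served inside S; as non-centres serve at most one unit each, these S-vertices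
-- split into two halves of size s served by complementary parts of the component containing u and w.

{-# OPTIONS --safe #-}
module Submission where

open import Data.Fin.Base using (Fin)
open import Data.Fin.Subset using (Subset)
open import Data.Nat.Base using (ℕ)

module Subsets where

  open import Data.Bool.Base using (true; false; if_then_else_)
  open import Data.Fin.Base using (Fin; zero; suc; punchOut)
  import Data.Fin.Properties as Finₚ
  open import Data.Fin.Subset
  open import Data.Fin.Subset.Properties
    using (_∈?_; ∉⊥; ⊥⊆; Empty-unique; ∣⊥∣≡0; x∈p∩q⁺; x∈p∩q⁻; x∈p∪q⁺; x∈p∪q⁻; p⊆q⇒∣p∣≤∣q∣;
           x∈⁅x⁆; ∣⁅x⁆∣≡1; p─⊥≡p; x∈p∧x≢y⇒x∈p-y; drop-∷-⊆; s⊆s; out⊆; ⊆-refl)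
  open import Data.Nat.Base using (ℕ; zero; suc; pred; _+_; _*_; _≤_; z≤n; s≤s; >-nonZero)
  open import Data.Nat.Properties
  open import Algebra.Properties.CommutativeSemigroup +-commutativeSemigroup using (interchange; x∙yz≈y∙xz)
  open import Data.Product using (∃; ∃₂; _×_; _,_; proj₂)
  open import Data.Sum using (_⊎_; inj₁; inj₂)
  open import Data.Vec.Base using ([]; _∷_; here; there; tabulate; lookup)
  open import Data.Vec.Properties using ([]=⇒lookup; lookup⇒[]=; lookup∘tabulate)
  open import Data.Vec.Functional using (updateAt)
  open import Data.Vec.Functional.Properties using (updateAt-updates; updateAt-minimal)
  open import Function.Base using (_∘_; case_of_)
  open import Level using (Level)
  open import Relation.Binary.PropositionalEquality
  open import Relation.Nullary using (¬_; yes; no; does; contradiction)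
  open import Relation.Nullary.Decidable using (dec-true; _×-dec_; ¬?; decidable-stable)
  open import Relation.Unary using (Pred; Decidable)

  private
    variable
      ℓ : Level
      n m k : ℕ
      p q : Subset n
      x y : Fin n

  toSubset : {P : Pred (Fin n) ℓ} → Decidable P → Subset n
  toSubset P? = tabulate (does ∘ P?)

  ∈-toSubset⁺ : {P : Pred (Fin n) ℓ} (P? : Decidable P) → P x → x ∈ toSubset P?
  ∈-toSubset⁺ {x = x} P? px = lookup⇒[]= x _ (trans (lookup∘tabulate (does ∘ P?) x) (dec-true (P? x) px))

  ∈-toSubset⁻ : {P : Pred (Fin n) ℓ} (P? : Decidable P) → x ∈ toSubset P? → P x
  ∈-toSubset⁻ {x = x} P? x∈ with P? x | trans (sym (lookup∘tabulate (does ∘ P?) x)) ([]=⇒lookup x∈)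
  ... | yes px | _  = px
  ... | no  _  | ()

  two-elements : ∀ (p : Subset n) → Nonempty p → ∃₂ λ x y → x ∈ p × y ∈ p × (x ≢ y ⊎ p ⊆ ⁅ x ⁆)
  two-elements p (x , x∈p) with Finₚ.any? (λ y → y ∈? p ×-dec ¬? (y Finₚ.≟ x))
  ... | yes (y , y∈p , y≢x) = x , y , x∈p , y∈p , inj₁ (y≢x ∘ sym)
  ... | no  none            = x , x , x∈p , x∈p , inj₂ λ {y} y∈p →
    subst (_∈ ⁅ x ⁆) (sym (decidable-stable (y Finₚ.≟ x) λ y≢x → none (y , y∈p , y≢x))) (x∈⁅x⁆ x)

  two-indices : 2 ≤ m → ∃₂ λ (i j : Fin m) → i ≢ j
  two-indices (s≤s (s≤s _)) = zero , suc zero , λ ()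

  p⊈q⇒∃ : ∀ (p q : Subset n) → ¬ (p ⊆ q) → ∃ λ x → x ∈ p × x ∉ q
  p⊈q⇒∃ p q p⊈q with Finₚ.any? (λ x → x ∈? p ×-dec ¬? (x ∈? q))
  ... | yes found = found
  ... | no  none  = contradiction (λ {x} x∈p → decidable-stable (x ∈? q) λ x∉q → none (x , x∈p , x∉q)) p⊈q

  x∈p-y⇒x≢y : ∀ (p : Subset n) → x ∈ p - y → x ≢ y
  x∈p-y⇒x≢y {x = zero}  {y = zero}  (_ ∷ p) ()
  x∈p-y⇒x≢y {x = suc x} {y = zero}  (_ ∷ p) _             ()
  x∈p-y⇒x≢y {x = zero}  {y = suc y} (_ ∷ p) _             ()
  x∈p-y⇒x≢y {x = suc x} {y = suc y} (_ ∷ p) (there x∈p-y) = x∈p-y⇒x≢y p x∈p-y ∘ Finₚ.suc-injective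

  ∣p∪q∣+∣p∩q∣≡∣p∣+∣q∣ : ∀ (p q : Subset n) → ∣ p ∪ q ∣ + ∣ p ∩ q ∣ ≡ ∣ p ∣ + ∣ q ∣
  ∣p∪q∣+∣p∩q∣≡∣p∣+∣q∣ []            []            = refl
  ∣p∪q∣+∣p∩q∣≡∣p∣+∣q∣ (inside  ∷ p) (inside  ∷ q) =
    cong suc (trans (+-suc _ _) (trans (cong suc (∣p∪q∣+∣p∩q∣≡∣p∣+∣q∣ p q)) (sym (+-suc _ _))))
  ∣p∪q∣+∣p∩q∣≡∣p∣+∣q∣ (inside  ∷ p) (outside ∷ q) = cong suc (∣p∪q∣+∣p∩q∣≡∣p∣+∣q∣ p q)
  ∣p∪q∣+∣p∩q∣≡∣p∣+∣q∣ (outside ∷ p) (inside  ∷ q) = trans (cong suc (∣p∪q∣+∣p∩q∣≡∣p∣+∣q∣ p q)) (sym (+-suc _ _))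
  ∣p∪q∣+∣p∩q∣≡∣p∣+∣q∣ (outside ∷ p) (outside ∷ q) = ∣p∪q∣+∣p∩q∣≡∣p∣+∣q∣ p q

  ∣p∪q∣≤∣p∣+∣q∣ : ∀ (p q : Subset n) → ∣ p ∪ q ∣ ≤ ∣ p ∣ + ∣ q ∣
  ∣p∪q∣≤∣p∣+∣q∣ p q = subst (∣ p ∪ q ∣ ≤_) (∣p∪q∣+∣p∩q∣≡∣p∣+∣q∣ p q) (m≤m+n _ _)

  ∣p∪q∣≡∣p∣+∣q∣ : ∀ (p q : Subset n) → (∀ {x} → x ∈ p → x ∉ q) → ∣ p ∪ q ∣ ≡ ∣ p ∣ + ∣ q ∣
  ∣p∪q∣≡∣p∣+∣q∣ {n} p q disjoint = begin
    ∣ p ∪ q ∣               ≡⟨ +-identityʳ _ ⟨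
    ∣ p ∪ q ∣ + 0           ≡⟨ cong (∣ p ∪ q ∣ +_) (trans (cong ∣_∣ p∩q≡⊥) (∣⊥∣≡0 n)) ⟨
    ∣ p ∪ q ∣ + ∣ p ∩ q ∣   ≡⟨ ∣p∪q∣+∣p∩q∣≡∣p∣+∣q∣ p q ⟩
    ∣ p ∣ + ∣ q ∣           ∎
    where
    open ≡-Reasoning
    p∩q≡⊥ : p ∩ q ≡ ⊥
    p∩q≡⊥ = Empty-unique λ (x , x∈p∩q) → let x∈p , x∈q = x∈p∩q⁻ p q x∈p∩q in disjoint x∈p x∈q

  ∣p∣≡∣p∩q∣+∣p∩∁q∣ : ∀ (p q : Subset n) → ∣ p ∣ ≡ ∣ p ∩ q ∣ + ∣ p ∩ ∁ q ∣
  ∣p∣≡∣p∩q∣+∣p∩∁q∣ []            []            = refl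
  ∣p∣≡∣p∩q∣+∣p∩∁q∣ (inside  ∷ p) (inside  ∷ q) = cong suc (∣p∣≡∣p∩q∣+∣p∩∁q∣ p q)
  ∣p∣≡∣p∩q∣+∣p∩∁q∣ (inside  ∷ p) (outside ∷ q) = trans (cong suc (∣p∣≡∣p∩q∣+∣p∩∁q∣ p q)) (sym (+-suc _ _))
  ∣p∣≡∣p∩q∣+∣p∩∁q∣ (outside ∷ p) (inside  ∷ q) = ∣p∣≡∣p∩q∣+∣p∩∁q∣ p q
  ∣p∣≡∣p∩q∣+∣p∩∁q∣ (outside ∷ p) (outside ∷ q) = ∣p∣≡∣p∩q∣+∣p∩∁q∣ p q

  ∣p∩q∣≤1+∣p∩q-y∣ : ∀ (p q : Subset n) y → ∣ p ∩ q ∣ ≤ suc ∣ p ∩ (q - y) ∣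
  ∣p∩q∣≤1+∣p∩q-y∣ p q y = begin
    ∣ p ∩ q ∣                          ≤⟨ p⊆q⇒∣p∣≤∣q∣ p∩q⊆ ⟩
    ∣ ⁅ y ⁆ ∪ p ∩ (q - y) ∣            ≤⟨ ∣p∪q∣≤∣p∣+∣q∣ ⁅ y ⁆ (p ∩ (q - y)) ⟩
    ∣ ⁅ y ⁆ ∣ + ∣ p ∩ (q - y) ∣        ≡⟨ cong (_+ ∣ p ∩ (q - y) ∣) (∣⁅x⁆∣≡1 y) ⟩
    suc ∣ p ∩ (q - y) ∣                ∎
    where
    open ≤-Reasoning
    p∩q⊆ : p ∩ q ⊆ ⁅ y ⁆ ∪ p ∩ (q - y)
    p∩q⊆ {x} x∈p∩q with x Finₚ.≟ y | x∈p∩q⁻ p q x∈p∩q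
    ... | yes refl | _         = x∈p∪q⁺ (inj₁ (x∈⁅x⁆ x))
    ... | no  x≢y  | x∈p , x∈q = x∈p∪q⁺ (inj₂ (x∈p∩q⁺ (x∈p , x∈p∧x≢y⇒x∈p-y x∈q x≢y)))

  x∈p⇒1≤∣p∣ : x ∈ p → 1 ≤ ∣ p ∣
  x∈p⇒1≤∣p∣ {p = inside  ∷ p} _           = s≤s z≤n
  x∈p⇒1≤∣p∣ {p = outside ∷ p} (there x∈p) = x∈p⇒1≤∣p∣ x∈p

  1≤∣p∣⇒Nonempty : ∀ (p : Subset n) → 1 ≤ ∣ p ∣ → Nonempty p
  1≤∣p∣⇒Nonempty (inside  ∷ p) _     = zero , here
  1≤∣p∣⇒Nonempty (outside ∷ p) 1≤∣p∣ = let x , x∈p = 1≤∣p∣⇒Nonempty p 1≤∣p∣ in suc x , there x∈p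

  ∣p∣≤1∧x∈p∧y∈p⇒x≡y : ∀ (p : Subset n) → ∣ p ∣ ≤ 1 → x ∈ p → y ∈ p → x ≡ y
  ∣p∣≤1∧x∈p∧y∈p⇒x≡y (inside  ∷ p) _           here        here        = refl
  ∣p∣≤1∧x∈p∧y∈p⇒x≡y (inside  ∷ p) (s≤s ∣p∣≤0) here        (there y∈p) = contradiction (≤-trans (x∈p⇒1≤∣p∣ y∈p) ∣p∣≤0) λ ()
  ∣p∣≤1∧x∈p∧y∈p⇒x≡y (inside  ∷ p) (s≤s ∣p∣≤0) (there x∈p) _           = contradiction (≤-trans (x∈p⇒1≤∣p∣ x∈p) ∣p∣≤0) λ ()
  ∣p∣≤1∧x∈p∧y∈p⇒x≡y (outside ∷ p) ∣p∣≤1       (there x∈p) (there y∈p) = cong suc (∣p∣≤1∧x∈p∧y∈p⇒x≡y p ∣p∣≤1 x∈p y∈p)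

  subset-of-size-between : ∀ (a b : Subset n) → a ⊆ b → ∣ a ∣ ≤ k → k ≤ ∣ b ∣ → ∃ λ c → a ⊆ c × c ⊆ b × ∣ c ∣ ≡ k
  subset-of-size-between []            []            _   _ k≤0 = [] , (λ ()) , (λ ()) , sym (n≤0⇒n≡0 k≤0)
  subset-of-size-between (inside  ∷ a) (outside ∷ b) a⊆b _ _   = contradiction (a⊆b here) λ ()
  subset-of-size-between {k = suc k} (inside ∷ a) (inside ∷ b) a⊆b (s≤s a≤k) (s≤s k≤b) =
    let c , a⊆c , c⊆b , ∣c∣≡k = subset-of-size-between a b (drop-∷-⊆ a⊆b) a≤k k≤b
    in inside ∷ c , s⊆s a⊆c , s⊆s c⊆b , cong suc ∣c∣≡k
  subset-of-size-between (outside ∷ a) (outside ∷ b) a⊆b a≤k k≤b =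
    let c , a⊆c , c⊆b , ∣c∣≡k = subset-of-size-between a b (drop-∷-⊆ a⊆b) a≤k k≤b
    in outside ∷ c , s⊆s a⊆c , s⊆s c⊆b , ∣c∣≡k
  subset-of-size-between {k = k} (outside ∷ a) (inside ∷ b) a⊆b a≤k k≤1+∣b∣ with k ≤? ∣ b ∣
  ... | yes k≤b =
    let c , a⊆c , c⊆b , ∣c∣≡k = subset-of-size-between a b (drop-∷-⊆ a⊆b) a≤k k≤b
    in outside ∷ c , s⊆s a⊆c , out⊆ c⊆b , ∣c∣≡k
  ... | no  k≰b = inside ∷ b , out⊆ (drop-∷-⊆ a⊆b) , ⊆-refl , ≤-antisym (≰⇒> k≰b) k≤1+∣b∣

  subset-of-size : ∀ (b : Subset n) → k ≤ ∣ b ∣ → ∃ λ c → c ⊆ b × ∣ c ∣ ≡ k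
  subset-of-size {n} b k≤∣b∣ =
    let c , _ , c⊆b , ∣c∣≡k = subset-of-size-between ⊥ b ⊥⊆ (≤-trans (≤-reflexive (∣⊥∣≡0 n)) z≤n) k≤∣b∣
    in c , c⊆b , ∣c∣≡k

  injection⇒∣p∣≤m : ∀ (p : Subset n) (h : ∀ x → x ∈ p → Fin m)
                  → (∀ {x y} x∈p y∈p → h x x∈p ≡ h y y∈p → x ≡ y) → ∣ p ∣ ≤ m
  injection⇒∣p∣≤m []            h h-inj = z≤n
  injection⇒∣p∣≤m (outside ∷ p) h h-inj =
    injection⇒∣p∣≤m p (λ x x∈p → h (suc x) (there x∈p)) λ x∈p y∈p → Finₚ.suc-injective ∘ h-inj (there x∈p) (there y∈p)
  injection⇒∣p∣≤m {m = zero}  (inside ∷ p) h h-inj with h zero here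
  ... | ()
  injection⇒∣p∣≤m {m = suc m} (inside ∷ p) h h-inj = s≤s (injection⇒∣p∣≤m p h′ λ x∈p y∈p →
    Finₚ.suc-injective ∘ h-inj (there x∈p) (there y∈p) ∘ Finₚ.punchOut-injective (h₀≢ x∈p) (h₀≢ y∈p))
    where
    h₀≢ : ∀ {x} (x∈p : x ∈ p) → h zero here ≢ h (suc x) (there x∈p)
    h₀≢ x∈p h₀≡ = case h-inj here (there x∈p) h₀≡ of λ ()
    h′ : ∀ x → x ∈ p → Fin m
    h′ x x∈p = punchOut (h₀≢ x∈p)

  sumOver : Subset n → (Fin n → ℕ) → ℕ
  sumOver []            f = 0
  sumOver (inside  ∷ p) f = f zero + sumOver p (f ∘ suc)
  sumOver (outside ∷ p) f = sumOver p (f ∘ suc)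

  restrict : Subset n → (Fin n → ℕ) → Fin n → ℕ
  restrict q f x = if lookup q x then f x else 0

  indicator : Subset n → Fin n → ℕ
  indicator q = restrict q (λ _ → 1)

  indicator-∈ : x ∈ q → indicator q x ≡ 1
  indicator-∈ x∈q rewrite []=⇒lookup x∈q = refl

  indicator-∉ : x ∉ q → indicator q x ≡ 0
  indicator-∉ {x = x} {q = q} x∉q with lookup q x in eq
  ... | true  = contradiction (lookup⇒[]= x q eq) x∉q
  ... | false = refl

  sumOver-cong : ∀ p {f g : Fin n → ℕ} → (∀ {x} → x ∈ p → f x ≡ g x) → sumOver p f ≡ sumOver p g
  sumOver-cong []            f≗g = refl
  sumOver-cong (inside  ∷ p) f≗g = cong₂ _+_ (f≗g here) (sumOver-cong p (f≗g ∘ there))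
  sumOver-cong (outside ∷ p) f≗g = sumOver-cong p (f≗g ∘ there)

  sumOver-mono : ∀ {p q : Subset n} f → p ⊆ q → sumOver p f ≤ sumOver q f
  sumOver-mono {p = []}          {[]}          f p⊆q = z≤n
  sumOver-mono {p = inside  ∷ p} {inside  ∷ q} f p⊆q = +-monoʳ-≤ (f zero) (sumOver-mono (f ∘ suc) (drop-∷-⊆ p⊆q))
  sumOver-mono {p = inside  ∷ p} {outside ∷ q} f p⊆q = contradiction (p⊆q here) λ ()
  sumOver-mono {p = outside ∷ p} {inside  ∷ q} f p⊆q = ≤-trans (sumOver-mono (f ∘ suc) (drop-∷-⊆ p⊆q)) (m≤n+m _ (f zero))
  sumOver-mono {p = outside ∷ p} {outside ∷ q} f p⊆q = sumOver-mono (f ∘ suc) (drop-∷-⊆ p⊆q)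

  sumOver-∪ : ∀ (p q : Subset n) f → (∀ {x} → x ∈ p → x ∉ q) → sumOver (p ∪ q) f ≡ sumOver p f + sumOver q f
  sumOver-∪ []            []            f disjoint = refl
  sumOver-∪ (inside  ∷ p) (inside  ∷ q) f disjoint = contradiction here (disjoint here)
  sumOver-∪ (inside  ∷ p) (outside ∷ q) f disjoint =
    trans (cong (f zero +_) (sumOver-∪ p q (f ∘ suc) (λ x∈p → disjoint (there x∈p) ∘ there))) (sym (+-assoc (f zero) _ _))
  sumOver-∪ (outside ∷ p) (inside  ∷ q) f disjoint =
    trans (cong (f zero +_) (sumOver-∪ p q (f ∘ suc) (λ x∈p → disjoint (there x∈p) ∘ there)))
          (x∙yz≈y∙xz (f zero) (sumOver p (f ∘ suc)) _)
  sumOver-∪ (outside ∷ p) (outside ∷ q) f disjoint = sumOver-∪ p q (f ∘ suc) (λ x∈p → disjoint (there x∈p) ∘ there)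

  sumOver-remove : ∀ (p : Subset n) f → x ∈ p → sumOver p f ≡ f x + sumOver (p - x) f
  sumOver-remove (inside  ∷ p) f here                = cong (λ r → f zero + sumOver r (f ∘ suc)) (sym (p─⊥≡p p))
  sumOver-remove (inside  ∷ p) f (there {i = x} x∈p) =
    trans (cong (f zero +_) (sumOver-remove p (f ∘ suc) x∈p)) (x∙yz≈y∙xz (f zero) (f (suc x)) _)
  sumOver-remove (outside ∷ p) f (there x∈p)         = sumOver-remove p (f ∘ suc) x∈p

  sumOver-restrict : ∀ (p q : Subset n) f → sumOver p (restrict q f) ≡ sumOver (p ∩ q) f
  sumOver-restrict []            []            f = refl
  sumOver-restrict (inside  ∷ p) (inside  ∷ q) f = cong (f zero +_) (sumOver-restrict p q (f ∘ suc))
  sumOver-restrict (inside  ∷ p) (outside ∷ q) f = sumOver-restrict p q (f ∘ suc)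
  sumOver-restrict (outside ∷ p) (_       ∷ q) f = sumOver-restrict p q (f ∘ suc)

  sumOver-1 : ∀ (p : Subset n) → sumOver p (λ _ → 1) ≡ ∣ p ∣
  sumOver-1 []            = refl
  sumOver-1 (inside  ∷ p) = cong suc (sumOver-1 p)
  sumOver-1 (outside ∷ p) = sumOver-1 p

  sumOver-indicator : ∀ (p q : Subset n) → sumOver p (indicator q) ≡ ∣ p ∩ q ∣
  sumOver-indicator p q = trans (sumOver-restrict p q _) (sumOver-1 (p ∩ q))

  sumOver-+ : ∀ (p : Subset n) f g → sumOver p (λ x → f x + g x) ≡ sumOver p f + sumOver p g
  sumOver-+ []            f g = refl
  sumOver-+ (inside  ∷ p) f g =
    trans (cong (f zero + g zero +_) (sumOver-+ p (f ∘ suc) (g ∘ suc))) (interchange (f zero) (g zero) _ _)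
  sumOver-+ (outside ∷ p) f g = sumOver-+ p (f ∘ suc) (g ∘ suc)

  sumOver-* : ∀ (p : Subset n) k f → sumOver p (λ x → k * f x) ≡ k * sumOver p f
  sumOver-* []            k f = sym (*-zeroʳ k)
  sumOver-* (inside  ∷ p) k f = trans (cong (k * f zero +_) (sumOver-* p k (f ∘ suc))) (sym (*-distribˡ-+ k (f zero) _))
  sumOver-* (outside ∷ p) k f = sumOver-* p k (f ∘ suc)

  unionOver : Subset n → (Fin n → Subset m) → Subset m
  unionOver []            F = ⊥
  unionOver (inside  ∷ p) F = F zero ∪ unionOver p (F ∘ suc)
  unionOver (outside ∷ p) F = unionOver p (F ∘ suc)

  ∈-unionOver⁺ : ∀ (p : Subset n) (F : Fin n → Subset m) {y} → x ∈ p → y ∈ F x → y ∈ unionOver p F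
  ∈-unionOver⁺ (inside  ∷ p) F here        y∈Fx = x∈p∪q⁺ (inj₁ y∈Fx)
  ∈-unionOver⁺ (inside  ∷ p) F (there x∈p) y∈Fx = x∈p∪q⁺ (inj₂ (∈-unionOver⁺ p (F ∘ suc) x∈p y∈Fx))
  ∈-unionOver⁺ (outside ∷ p) F (there x∈p) y∈Fx = ∈-unionOver⁺ p (F ∘ suc) x∈p y∈Fx

  ∈-unionOver⁻ : ∀ (p : Subset n) (F : Fin n → Subset m) {y} → y ∈ unionOver p F → ∃ λ x → x ∈ p × y ∈ F x
  ∈-unionOver⁻ []            F y∈⊥ = contradiction y∈⊥ ∉⊥
  ∈-unionOver⁻ (inside  ∷ p) F y∈∪ with x∈p∪q⁻ (F zero) _ y∈∪
  ... | inj₁ y∈F₀ = zero , here , y∈F₀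
  ... | inj₂ y∈∪′ = let x , x∈p , y∈Fx = ∈-unionOver⁻ p (F ∘ suc) y∈∪′ in suc x , there x∈p , y∈Fx
  ∈-unionOver⁻ (outside ∷ p) F y∈∪ = let x , x∈p , y∈Fx = ∈-unionOver⁻ p (F ∘ suc) y∈∪ in suc x , there x∈p , y∈Fx

  unionOver-mono : ∀ {p q : Subset n} (F : Fin n → Subset m) → p ⊆ q → unionOver p F ⊆ unionOver q F
  unionOver-mono {p = p} {q} F p⊆q y∈ = let x , x∈p , y∈Fx = ∈-unionOver⁻ p F y∈ in ∈-unionOver⁺ q F (p⊆q x∈p) y∈Fx

  ∣unionOver∣≡sumOver : ∀ (p : Subset n) (F : Fin n → Subset m) → (∀ {x x′ y} → y ∈ F x → y ∈ F x′ → x ≡ x′)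
                      → ∣ unionOver p F ∣ ≡ sumOver p (∣_∣ ∘ F)
  ∣unionOver∣≡sumOver {m = m} []  F disjoint = ∣⊥∣≡0 m
  ∣unionOver∣≡sumOver (inside  ∷ p) F disjoint =
    trans (∣p∪q∣≡∣p∣+∣q∣ (F zero) _ F₀-apart) (cong (∣ F zero ∣ +_) (∣unionOver∣≡sumOver p (F ∘ suc) disjoint′))
    where
    disjoint′ : ∀ {x x′ y} → y ∈ F (suc x) → y ∈ F (suc x′) → x ≡ x′
    disjoint′ y∈Fx y∈Fx′ = Finₚ.suc-injective (disjoint y∈Fx y∈Fx′)
    F₀-apart : ∀ {y} → y ∈ F zero → y ∉ unionOver p (F ∘ suc)
    F₀-apart y∈F₀ y∈rest = case disjoint y∈F₀ (proj₂ (proj₂ (∈-unionOver⁻ p (F ∘ suc) y∈rest))) of λ ()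
  ∣unionOver∣≡sumOver (outside ∷ p) F disjoint =
    ∣unionOver∣≡sumOver p (F ∘ suc) λ y∈Fx y∈Fx′ → Finₚ.suc-injective (disjoint y∈Fx y∈Fx′)

  sumOver-decrement-∈ : ∀ (p : Subset n) (c : Fin n → ℕ) {v} → v ∈ p → 1 ≤ c v
                      → sumOver p c ≡ suc (sumOver p (updateAt c v pred))
  sumOver-decrement-∈ p c {v} v∈p 1≤cv = begin
    sumOver p c                          ≡⟨ sumOver-remove p c v∈p ⟩
    c v + sumOver (p - v) c              ≡⟨ cong₂ _+_ cv≡ (sumOver-cong (p - v) unchanged) ⟩
    suc (c′ v) + sumOver (p - v) c′      ≡⟨ cong suc (sumOver-remove p c′ v∈p) ⟨
    suc (sumOver p c′)                   ∎
    where
    open ≡-Reasoning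
    c′ = updateAt c v pred
    cv≡ : c v ≡ suc (c′ v)
    cv≡ = trans (sym (suc-pred (c v) {{>-nonZero 1≤cv}})) (cong suc (sym (updateAt-updates v c)))
    unchanged : ∀ {x} → x ∈ p - v → c x ≡ c′ x
    unchanged {x} x∈p-v = sym (updateAt-minimal x v c (x∈p-y⇒x≢y p x∈p-v))

  sumOver-decrement-∉ : ∀ (p : Subset n) (c : Fin n → ℕ) {v} → v ∉ p → sumOver p (updateAt c v pred) ≡ sumOver p c
  sumOver-decrement-∉ p c {v} v∉p = sumOver-cong p λ {x} x∈p → updateAt-minimal x v c λ x≡v → v∉p (subst (_∈ p) x≡v x∈p)

module CapacitatedHall {n m : ℕ} (N : Fin n → Subset m) where

  open Subsets
  open import Data.Bool.Base using (Bool; true; false; not; if_then_else_)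
  open import Data.Fin.Properties using (any?) renaming (_≟_ to _≟ᶠ_)
  open import Data.Fin.Subset
  open import Data.Fin.Subset.Properties
    using (_∈?_; ∉⊥; ⊥⊆; ∣⊥∣≡0; ∈⊤; x∈p∩q⁺; x∈p∩q⁻; x∈p∪q⁺; x∈p∪q⁻; x∈∁p⇒x∉p; x∉p⇒x∈∁p; p⊆q⇒∣p∣≤∣q∣;
           x∈⁅y⁆⇒x≡y; ∣⁅x⁆∣≡1; x∈⁅x⁆; x∈p∧x≢y⇒x∈p-y; p─q⊆p; p∪∁p≡⊤; ∩-identityˡ; anySubset?)
  open import Data.Nat.Base using (ℕ; zero; suc; pred; _+_; _≤_; _<_; z≤n; s≤s; >-nonZero)
  open import Data.Nat.Properties
  open import Data.Product using (∃; _×_; _,_; proj₁; proj₂)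
  open import Data.Sum using (_⊎_; inj₁; inj₂; [_,_]′)
  open import Data.Vec.Base using (lookup)
  open import Data.Vec.Properties using (lookup-map)
  open import Data.Vec.Functional using (updateAt)
  open import Data.Vec.Functional.Properties using (updateAt-updates; updateAt-minimal)
  open import Function.Base using (_∘_; flip)
  open import Relation.Binary.PropositionalEquality
  open import Relation.Nullary using (¬_; Dec; yes; no; contradiction)
  open import Relation.Nullary.Decidable using (_×-dec_)

  HallCondition : (Fin n → ℕ) → Subset m → Set
  HallCondition c R = ∀ Q → sumOver Q c ≤ ∣ unionOver Q N ∩ R ∣

  record Assignment (c : Fin n → ℕ) (R : Subset m) : Set where
    field
      assigned          : Fin n → Subset m
      assigned⊆N        : ∀ x → assigned x ⊆ N x
      assigned⊆R        : ∀ x → assigned x ⊆ R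
      ∣assigned∣        : ∀ x → ∣ assigned x ∣ ≡ c x
      assigned-disjoint : ∀ {x x′ y} → y ∈ assigned x → y ∈ assigned x′ → x ≡ x′

  open Assignment

  private
    variable
      c : Fin n → ℕ
      R : Subset m

  empty-assignment : (∀ x → c x ≡ 0) → Assignment c R
  empty-assignment c≡0 = record
    { assigned          = λ _ → ⊥
    ; assigned⊆N        = λ _ → ⊥⊆
    ; assigned⊆R        = λ _ → ⊥⊆
    ; ∣assigned∣        = λ x → trans (∣⊥∣≡0 m) (sym (c≡0 x))
    ; assigned-disjoint = λ y∈⊥ _ → contradiction y∈⊥ ∉⊥
    }

  Tight : (Fin n → ℕ) → Subset m → Subset n → Set
  Tight c R Q = 1 ≤ sumOver Q c × sumOver Q c < sumOver ⊤ c × ∣ unionOver Q N ∩ R ∣ ≤ sumOver Q c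

  Tight? : ∀ c R Q → Dec (Tight c R Q)
  Tight? c R Q = 1 ≤? sumOver Q c ×-dec sumOver Q c <? sumOver ⊤ c ×-dec ∣ unionOver Q N ∩ R ∣ ≤? sumOver Q c

  module _ (hall : HallCondition c R) (Q : Subset n) where

    inner-condition : HallCondition (restrict Q c) (R ∩ unionOver Q N)
    inner-condition P = begin
      sumOver P (restrict Q c)                  ≡⟨ sumOver-restrict P Q c ⟩
      sumOver (P ∩ Q) c                         ≤⟨ hall (P ∩ Q) ⟩
      ∣ unionOver (P ∩ Q) N ∩ R ∣               ≤⟨ p⊆q⇒∣p∣≤∣q∣ shrink ⟩
      ∣ unionOver P N ∩ (R ∩ unionOver Q N) ∣   ∎
      where
      open ≤-Reasoning
      shrink : unionOver (P ∩ Q) N ∩ R ⊆ unionOver P N ∩ (R ∩ unionOver Q N)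
      shrink y∈ with x∈p∩q⁻ _ R y∈
      ... | y∈N[P∩Q] , y∈R with ∈-unionOver⁻ (P ∩ Q) N y∈N[P∩Q]
      ...   | x , x∈P∩Q , y∈Nx with x∈p∩q⁻ P Q x∈P∩Q
      ...     | x∈P , x∈Q = x∈p∩q⁺ (∈-unionOver⁺ P N x∈P y∈Nx , x∈p∩q⁺ (y∈R , ∈-unionOver⁺ Q N x∈Q y∈Nx))

    outer-condition : ∣ unionOver Q N ∩ R ∣ ≤ sumOver Q c → HallCondition (restrict (∁ Q) c) (R ∩ ∁ (unionOver Q N))
    outer-condition tight P = +-cancelˡ-≤ (sumOver Q c) _ _ (begin
      sumOver Q c + sumOver P (restrict (∁ Q) c)       ≡⟨ cong (sumOver Q c +_) (sumOver-restrict P (∁ Q) c) ⟩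
      sumOver Q c + sumOver (P ∩ ∁ Q) c                ≡⟨ sumOver-∪ Q (P ∩ ∁ Q) c Q-apart ⟨
      sumOver (Q ∪ P ∩ ∁ Q) c                          ≤⟨ hall (Q ∪ P ∩ ∁ Q) ⟩
      ∣ unionOver (Q ∪ P ∩ ∁ Q) N ∩ R ∣                ≤⟨ p⊆q⇒∣p∣≤∣q∣ split ⟩
      ∣ unionOver Q N ∩ R ∪ unionOver P N ∩ R′ ∣       ≤⟨ ∣p∪q∣≤∣p∣+∣q∣ (unionOver Q N ∩ R) _ ⟩
      ∣ unionOver Q N ∩ R ∣ + ∣ unionOver P N ∩ R′ ∣   ≤⟨ +-monoˡ-≤ _ tight ⟩
      sumOver Q c + ∣ unionOver P N ∩ R′ ∣             ∎)
      where
      open ≤-Reasoning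
      R′ = R ∩ ∁ (unionOver Q N)
      Q-apart : ∀ {x} → x ∈ Q → x ∉ P ∩ ∁ Q
      Q-apart x∈Q x∈P∖Q = x∈∁p⇒x∉p (proj₂ (x∈p∩q⁻ P _ x∈P∖Q)) x∈Q
      split : unionOver (Q ∪ P ∩ ∁ Q) N ∩ R ⊆ unionOver Q N ∩ R ∪ unionOver P N ∩ R′
      split {y} y∈ with x∈p∩q⁻ _ R y∈
      ... | y∈N[Q∪P] , y∈R with y ∈? unionOver Q N
      ...   | yes y∈NQ = x∈p∪q⁺ (inj₁ (x∈p∩q⁺ (y∈NQ , y∈R)))
      ...   | no  y∉NQ with ∈-unionOver⁻ (Q ∪ P ∩ ∁ Q) N y∈N[Q∪P]
      ...     | x , x∈Q∪P∖Q , y∈Nx with x∈p∪q⁻ Q _ x∈Q∪P∖Q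
      ...       | inj₁ x∈Q   = contradiction (∈-unionOver⁺ Q N x∈Q y∈Nx) y∉NQ
      ...       | inj₂ x∈P∖Q = x∈p∪q⁺ (inj₂ (x∈p∩q⁺ (∈-unionOver⁺ P N (proj₁ (x∈p∩q⁻ P _ x∈P∖Q)) y∈Nx ,
                                                     x∈p∩q⁺ (y∈R , x∉p⇒x∈∁p y∉NQ))))

  merge : ∀ Q → Assignment (restrict Q c) (R ∩ unionOver Q N) → Assignment (restrict (∁ Q) c) (R ∩ ∁ (unionOver Q N))
        → Assignment c R
  merge {c = c} {R = R} Q A₁ A₂ = record
    { assigned          = λ x → pick (lookup Q x) x
    ; assigned⊆N        = λ x → pick⊆N (lookup Q x) x
    ; assigned⊆R        = λ x → pick⊆R (lookup Q x) x
    ; ∣assigned∣        = ∣pick∣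
    ; assigned-disjoint = λ {x} {x′} → pick-disjoint (lookup Q x) (lookup Q x′)
    }
    where
    pick : Bool → Fin n → Subset m
    pick true  = assigned A₁
    pick false = assigned A₂
    pick⊆N : ∀ b x → pick b x ⊆ N x
    pick⊆N true  = assigned⊆N A₁
    pick⊆N false = assigned⊆N A₂
    pick⊆R : ∀ b x → pick b x ⊆ R
    pick⊆R true  x = proj₁ ∘ x∈p∩q⁻ R _ ∘ assigned⊆R A₁ x
    pick⊆R false x = proj₁ ∘ x∈p∩q⁻ R _ ∘ assigned⊆R A₂ x
    ∣pick∣ : ∀ x → ∣ pick (lookup Q x) x ∣ ≡ c x
    ∣pick∣ x with lookup Q x in eq
    ... | true  = trans (∣assigned∣ A₁ x) (cong (λ b → if b then c x else 0) eq)
    ... | false = trans (∣assigned∣ A₂ x) (cong (λ b → if b then c x else 0) (trans (lookup-map x not Q) (cong not eq)))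
    in-Q : ∀ {x y} → y ∈ assigned A₁ x → y ∈ unionOver Q N
    in-Q {x} = proj₂ ∘ x∈p∩q⁻ R _ ∘ assigned⊆R A₁ x
    off-Q : ∀ {x y} → y ∈ assigned A₂ x → y ∉ unionOver Q N
    off-Q {x} = x∈∁p⇒x∉p ∘ proj₂ ∘ x∈p∩q⁻ R _ ∘ assigned⊆R A₂ x
    pick-disjoint : ∀ b b′ {x x′ y} → y ∈ pick b x → y ∈ pick b′ x′ → x ≡ x′
    pick-disjoint true  true  = assigned-disjoint A₁
    pick-disjoint false false = assigned-disjoint A₂
    pick-disjoint true  false y∈A₁ y∈A₂ = contradiction (in-Q y∈A₁) (off-Q y∈A₂)
    pick-disjoint false true  y∈A₂ y∈A₁ = contradiction (in-Q y∈A₁) (off-Q y∈A₂)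

  demand⇒candidate : HallCondition c R → ∀ {v} → 1 ≤ c v → ∃ λ y → y ∈ N v × y ∈ R
  demand⇒candidate {c = c} {R = R} hall {v} 1≤cv =
    let cv≤ = ≤-trans (m≤m+n (c v) _) (≤-reflexive (sym (sumOver-remove ⁅ v ⁆ c (x∈⁅x⁆ v))))
        y , y∈ = 1≤∣p∣⇒Nonempty (unionOver ⁅ v ⁆ N ∩ R) (≤-trans 1≤cv (≤-trans cv≤ (hall ⁅ v ⁆)))
        y∈N[v] , y∈R = x∈p∩q⁻ _ R y∈
        x , x∈⁅v⁆ , y∈Nx = ∈-unionOver⁻ ⁅ v ⁆ N y∈N[v]
    in y , subst (λ x → y ∈ N x) (x∈⁅y⁆⇒x≡y v x∈⁅v⁆) y∈Nx , y∈R

  decrement-condition : HallCondition c R → ¬ ∃ (Tight c R) → ∀ {v} y → 1 ≤ c v → HallCondition (updateAt c v pred) (R - y)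
  decrement-condition {c = c} {R = R} hall loose {v} y 1≤cv P with v ∈? P
  ... | yes v∈P = ≤-pred (begin
    suc (sumOver P (updateAt c v pred))    ≡⟨ sumOver-decrement-∈ P c v∈P 1≤cv ⟨
    sumOver P c                            ≤⟨ hall P ⟩
    ∣ unionOver P N ∩ R ∣                  ≤⟨ ∣p∩q∣≤1+∣p∩q-y∣ (unionOver P N) R y ⟩
    suc ∣ unionOver P N ∩ (R - y) ∣        ∎)
    where open ≤-Reasoning
  ... | no v∉P rewrite sumOver-decrement-∉ P c v∉P with 1 ≤? sumOver P c
  ...   | no  cP≱1 = ≤-trans (≤-reflexive (n<1⇒n≡0 (≰⇒> cP≱1))) z≤n
  ...   | yes 1≤cP = ≤-pred (≤-trans surplus (∣p∩q∣≤1+∣p∩q-y∣ (unionOver P N) R y))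
    where
    cP<T : sumOver P c < sumOver ⊤ c
    cP<T = begin-strict
      sumOver P c               ≤⟨ sumOver-mono {p = P} {q = ⊤ - v} c (λ x∈P → x∈p∧x≢y⇒x∈p-y ∈⊤ λ { refl → v∉P x∈P }) ⟩
      sumOver (⊤ - v) c         <⟨ m<n+m _ 1≤cv ⟩
      c v + sumOver (⊤ - v) c   ≡⟨ sumOver-remove ⊤ c ∈⊤ ⟨
      sumOver ⊤ c               ∎
      where open ≤-Reasoning
    surplus : sumOver P c < ∣ unionOver P N ∩ R ∣
    surplus = ≰⇒> λ tight → loose (P , 1≤cP , cP<T , tight)

  extend : ∀ {v y} → 1 ≤ c v → y ∈ N v → y ∈ R → Assignment (updateAt c v pred) (R - y) → Assignment c R
  extend {c = c} {R = R} {v} {y} 1≤cv y∈Nv y∈R A′ = record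
    { assigned          = A
    ; assigned⊆N        = λ x z∈Ax → [ assigned⊆N A′ x , (λ { (refl , refl) → y∈Nv }) ]′ (classify z∈Ax)
    ; assigned⊆R        = λ x z∈Ax → [ p─q⊆p R ⁅ y ⁆ ∘ assigned⊆R A′ x , (λ { (refl , refl) → y∈R }) ]′ (classify z∈Ax)
    ; ∣assigned∣        = ∣A∣
    ; assigned-disjoint = disjoint
    }
    where
    A : Fin n → Subset m
    A = updateAt (assigned A′) v (_∪ ⁅ y ⁆)
    classify : ∀ {x z} → z ∈ A x → z ∈ assigned A′ x ⊎ (x ≡ v × z ≡ y)
    classify {x} {z} z∈Ax with x ≟ᶠ v
    ... | no  x≢v  = inj₁ (subst (z ∈_) (updateAt-minimal x v _ x≢v) z∈Ax)
    ... | yes refl with x∈p∪q⁻ (assigned A′ v) ⁅ y ⁆ (subst (z ∈_) (updateAt-updates v _) z∈Ax)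
    ...   | inj₁ z∈A′v = inj₁ z∈A′v
    ...   | inj₂ z∈⁅y⁆ = inj₂ (refl , x∈⁅y⁆⇒x≡y y z∈⁅y⁆)
    y∉A′ : ∀ x → y ∉ assigned A′ x
    y∉A′ x y∈A′x = x∈p-y⇒x≢y R (assigned⊆R A′ x y∈A′x) refl
    ∣A∣ : ∀ x → ∣ A x ∣ ≡ c x
    ∣A∣ x with x ≟ᶠ v
    ... | no  x≢v  = trans (cong ∣_∣ (updateAt-minimal x v _ x≢v)) (trans (∣assigned∣ A′ x) (updateAt-minimal x v c x≢v))
    ... | yes refl = begin
      ∣ A v ∣                          ≡⟨ cong ∣_∣ (updateAt-updates v _) ⟩
      ∣ assigned A′ v ∪ ⁅ y ⁆ ∣        ≡⟨ ∣p∪q∣≡∣p∣+∣q∣ _ ⁅ y ⁆ (λ z∈A′ → y∉A′ v ∘ flip (subst (_∈ _)) z∈A′ ∘ x∈⁅y⁆⇒x≡y y) ⟩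
      ∣ assigned A′ v ∣ + ∣ ⁅ y ⁆ ∣    ≡⟨ cong₂ _+_ (trans (∣assigned∣ A′ v) (updateAt-updates v c)) (∣⁅x⁆∣≡1 y) ⟩
      pred (c v) + 1                   ≡⟨ +-comm _ 1 ⟩
      suc (pred (c v))                 ≡⟨ suc-pred (c v) {{>-nonZero 1≤cv}} ⟩
      c v                              ∎
      where open ≡-Reasoning
    disjoint : ∀ {x x′ z} → z ∈ A x → z ∈ A x′ → x ≡ x′
    disjoint z∈Ax z∈Ax′ with classify z∈Ax | classify z∈Ax′
    ... | inj₁ z∈A′x      | inj₁ z∈A′x′     = assigned-disjoint A′ z∈A′x z∈A′x′
    ... | inj₂ (refl , _) | inj₂ (refl , _) = refl
    ... | inj₁ z∈A′x      | inj₂ (_ , refl) = contradiction z∈A′x (y∉A′ _)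
    ... | inj₂ (_ , refl) | inj₁ z∈A′x′     = contradiction z∈A′x′ (y∉A′ _)

  private
    sumOver⊤-restrict : ∀ (Q : Subset n) c → sumOver ⊤ (restrict Q c) ≡ sumOver Q c
    sumOver⊤-restrict Q c = trans (sumOver-restrict ⊤ Q c) (cong (λ r → sumOver r c) (∩-identityˡ Q))

    sumOver⊤-split : ∀ (Q : Subset n) c → sumOver ⊤ c ≡ sumOver Q c + sumOver (∁ Q) c
    sumOver⊤-split Q c =
      trans (cong (λ r → sumOver r c) (sym (p∪∁p≡⊤ Q))) (sumOver-∪ Q (∁ Q) c λ x∈Q x∈∁Q → x∈∁p⇒x∉p x∈∁Q x∈Q)

  -- Halmos–Vaughan: split along a tight set if there is one, otherwise serve one unit of demand greedily.
  hall-bounded : ∀ fuel → sumOver ⊤ c ≤ fuel → HallCondition c R → Assignment c R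
  hall-bounded {c = c} {R = R} fuel T≤fuel hall with any? (λ x → 1 ≤? c x)
  ... | no  noDemand = empty-assignment λ x → n<1⇒n≡0 (≰⇒> λ 1≤cx → noDemand (x , 1≤cx))
  ... | yes (v , 1≤cv) with fuel | anySubset? (Tight? c R)
  ...   | zero     | _ = contradiction (trans (sym (sumOver-decrement-∈ ⊤ c ∈⊤ 1≤cv)) (n≤0⇒n≡0 T≤fuel)) λ ()
  ...   | suc fuel | yes (Q , 1≤cQ , cQ<T , tight) = merge Q
    (hall-bounded fuel (m<1+n⇒m≤n (<-≤-trans (subst (_< _) (sym (sumOver⊤-restrict Q c)) cQ<T) T≤fuel))
                  (inner-condition hall Q))
    (hall-bounded fuel (m<1+n⇒m≤n (<-≤-trans (subst (_< _) (sym (sumOver⊤-restrict (∁ Q) c)) c∁Q<T) T≤fuel))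
                  (outer-condition hall Q tight))
    where
    c∁Q<T : sumOver (∁ Q) c < sumOver ⊤ c
    c∁Q<T = ≤-trans (+-monoˡ-≤ _ 1≤cQ) (≤-reflexive (sym (sumOver⊤-split Q c)))
  ...   | suc fuel | no loose with demand⇒candidate hall 1≤cv
  ...     | y , y∈Nv , y∈R = extend 1≤cv y∈Nv y∈R
    (hall-bounded fuel (m<1+n⇒m≤n (<-≤-trans (≤-reflexive (sym (sumOver-decrement-∈ ⊤ c ∈⊤ 1≤cv))) T≤fuel))
                  (decrement-condition hall loose y 1≤cv))

  hall : ∀ {c} → HallCondition c ⊤ → Assignment c ⊤
  hall {c} = hall-bounded (sumOver ⊤ c) ≤-refl

module Components where

  open Subsets
  open import Defs hiding (sym)
  open import Data.Bool.Base using (true; false)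
  import Data.Bool.Properties as Boolₚ
  open import Data.Empty using (⊥-elim)
  open import Data.Fin.Base using (Fin; zero; suc)
  open import Data.Fin.Subset
  open import Data.Fin.Subset.Properties
    using (_∈?_; _⊆?_; ⊆-antisym; x∈p∩q⁺; x∈p∩q⁻; x∈p∪q⁺; x∈p∪q⁻; x∈∁p⇒x∉p; x∉p⇒x∈∁p; x∈⁅x⁆; x∈⁅y⁆⇒x≡y;
           ∣⁅x⁆∣≡1; ∣p∣≤n; p⊂q⇒∣p∣<∣q∣)
  open import Data.List.Base using (List; _∷_; length; map; filter; deduplicate; allFin; lookup)
  import Data.List.Membership.Propositional as List
  open import Data.List.Membership.Propositional.Properties
    using (∈-map⁺; ∈-map⁻; ∈-filter⁺; ∈-filter⁻; ∈-allFin; ∈-deduplicate⁺; ∈-deduplicate⁻; ∈-lookup)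
  open import Data.List.Relation.Unary.All using (tabulate)
  import Data.List.Relation.Unary.All as All
  open import Data.List.Relation.Unary.Any using (index)
  open import Data.List.Relation.Unary.Any.Properties using (lookup-index)
  open import Data.List.Relation.Unary.Unique.Propositional using (Unique; _∷_)
  open import Data.List.Relation.Unary.Unique.DecPropositional.Properties using (deduplicate-!)
  open import Data.Nat.Base using (ℕ; zero; suc; _≤_; s≤s)
  open import Data.Nat.Properties using (≤-reflexive; <-≤-trans; n≮n)
  open import Data.Product using (∃; _×_; _,_; proj₁; proj₂)
  open import Data.Sum using (_⊎_; inj₁; inj₂)
  open import Data.Vec.Properties using (≡-dec)
  open import Function.Base using (_∘_; case_of_)
  open import Relation.Binary.PropositionalEquality
  open import Relation.Nullary using (yes; no; contradiction)
  open import Relation.Nullary.Decidable using (¬?)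

  Unique⇒lookup-injective : ∀ {a} {A : Set a} (xs : List A) → Unique xs → ∀ i j → lookup xs i ≡ lookup xs j → i ≡ j
  Unique⇒lookup-injective (x ∷ xs) (x∉xs ∷ unique) zero    zero    _  = refl
  Unique⇒lookup-injective (x ∷ xs) (x∉xs ∷ unique) zero    (suc j) eq = contradiction eq (All.lookup x∉xs (∈-lookup j))
  Unique⇒lookup-injective (x ∷ xs) (x∉xs ∷ unique) (suc i) zero    eq = contradiction (sym eq) (All.lookup x∉xs (∈-lookup i))
  Unique⇒lookup-injective (x ∷ xs) (x∉xs ∷ unique) (suc i) (suc j) eq = cong suc (Unique⇒lookup-injective xs unique i j eq)

  module _ (G : Graph) where

    private
      variable
        D D′ S : VSet G
        a b c : V G

    reach-trans : Reach G D a b → Reach G D b c → Reach G D a c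
    reach-trans here             b↝c = b↝c
    reach-trans (step e x∈D x↝b) b↝c = step e x∈D (reach-trans x↝b b↝c)

    reach-snoc : Reach G D a b → adj G b c ≡ true → c ∈ D → Reach G D a c
    reach-snoc a↝b e c∈D = reach-trans a↝b (step e c∈D here)

    reach-sym : a ∈ D → Reach G D a b → Reach G D b a
    reach-sym a∈D here             = here
    reach-sym a∈D (step e x∈D x↝b) = reach-snoc (reach-sym x∈D x↝b) (trans (Graph.sym G _ _) e) a∈D

    reach-mono : D ⊆ D′ → Reach G D a b → Reach G D′ a b
    reach-mono D⊆D′ here             = here
    reach-mono D⊆D′ (step e x∈D x↝b) = step e (D⊆D′ x∈D) (reach-mono D⊆D′ x↝b)

    reach-end : Reach G D a b → a ≡ b ⊎ b ∈ D
    reach-end here = inj₁ refl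
    reach-end (step e x∈D x↝b) with reach-end x↝b
    ... | inj₁ refl = inj₂ x∈D
    ... | inj₂ b∈D  = inj₂ b∈D

    StepClosed : VSet G → VSet G → Set
    StepClosed D P = ∀ {x y} → x ∈ P → adj G x y ≡ true → y ∈ D → y ∈ P

    reach-restrict : ∀ {P} → StepClosed D P → a ∈ P → Reach G D a b → Reach G P a b
    reach-restrict closed a∈P here             = here
    reach-restrict closed a∈P (step e x∈D x↝b) = let x∈P = closed a∈P e x∈D in step e x∈P (reach-restrict closed x∈P x↝b)

    reach-closed : ∀ {P} → StepClosed D P → a ∈ P → Reach G D a b → b ∈ P
    reach-closed closed a∈P here             = a∈P
    reach-closed closed a∈P (step e x∈D x↝b) = reach-closed closed (closed a∈P e x∈D) x↝b

    neighbours : V G → VSet G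
    neighbours x = toSubset (λ y → adj G x y Boolₚ.≟ true)

    ∈-neighbours⁺ : adj G a b ≡ true → b ∈ neighbours a
    ∈-neighbours⁺ {a} = ∈-toSubset⁺ (λ y → adj G a y Boolₚ.≟ true)

    ∈-neighbours⁻ : b ∈ neighbours a → adj G a b ≡ true
    ∈-neighbours⁻ {a = a} = ∈-toSubset⁻ (λ y → adj G a y Boolₚ.≟ true)

    expand : VSet G → VSet G → VSet G
    expand D X = X ∪ D ∩ unionOver X neighbours

    ∈-expand⁺ : ∀ {X} → a ∈ X → adj G a b ≡ true → b ∈ D → b ∈ expand D X
    ∈-expand⁺ {X = X} a∈X e b∈D = x∈p∪q⁺ (inj₂ (x∈p∩q⁺ (b∈D , ∈-unionOver⁺ X neighbours a∈X (∈-neighbours⁺ e))))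

    ∈-expand⁻ : ∀ {X} → b ∈ expand D X → b ∈ X ⊎ (b ∈ D × ∃ λ a → a ∈ X × adj G a b ≡ true)
    ∈-expand⁻ {D = D} {X = X} b∈ with x∈p∪q⁻ X _ b∈
    ... | inj₁ b∈X = inj₁ b∈X
    ... | inj₂ b∈D∩N with x∈p∩q⁻ D _ b∈D∩N
    ...   | b∈D , b∈N with ∈-unionOver⁻ X neighbours b∈N
    ...     | a , a∈X , b∈Na = inj₂ (b∈D , a , a∈X , ∈-neighbours⁻ b∈Na)

    ball : VSet G → V G → ℕ → VSet G
    ball D v zero    = ⁅ v ⁆
    ball D v (suc k) = expand D (ball D v k)

    ball-⊆-suc : ∀ {v} k → ball D v k ⊆ ball D v (suc k)
    ball-⊆-suc k = x∈p∪q⁺ ∘ inj₁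

    centre∈ball : ∀ {v} k → v ∈ ball D v k
    centre∈ball zero    = x∈⁅x⁆ _
    centre∈ball (suc k) = ball-⊆-suc k (centre∈ball k)

    ball-sound : ∀ {v} k → b ∈ ball D v k → Reach G D v b
    ball-sound {v = v} zero b∈ rewrite x∈⁅y⁆⇒x≡y v b∈ = here
    ball-sound (suc k) b∈ with ∈-expand⁻ b∈
    ... | inj₁ b∈ball                 = ball-sound k b∈ball
    ... | inj₂ (b∈D , a , a∈ball , e) = reach-snoc (ball-sound k a∈ball) e b∈D

    ball-grows : ∀ v k → suc k ≤ ∣ ball D v k ∣ ⊎ expand D (ball D v k) ⊆ ball D v k
    ball-grows v zero = inj₁ (≤-reflexive (sym (∣⁅x⁆∣≡1 v)))
    ball-grows {D = D} v (suc k) with expand D (ball D v k) ⊆? ball D v k | ball-grows v k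
    ... | yes closed | _             = inj₂ (subst (λ X → expand D X ⊆ X) (⊆-antisym (ball-⊆-suc k) closed) closed)
    ... | no  open′  | inj₂ closed   = ⊥-elim (open′ closed)
    ... | no  open′  | inj₁ k<∣ball∣ = inj₁ (<-≤-trans (s≤s k<∣ball∣) (p⊂q⇒∣p∣<∣q∣ (ball-⊆-suc k , p⊈q⇒∃ _ _ open′)))

    reachable : VSet G → V G → VSet G
    reachable D v = ball D v (n G)

    reachable-closed : ∀ v → StepClosed D (reachable D v)
    reachable-closed {D = D} v a∈ e b∈D with ball-grows {D = D} v (n G)
    ... | inj₁ N<∣ball∣ = contradiction (<-≤-trans N<∣ball∣ (∣p∣≤n (reachable D v))) (n≮n (n G))
    ... | inj₂ closed   = closed (∈-expand⁺ a∈ e b∈D)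

    reachable-sound : ∀ {v} → b ∈ reachable D v → Reach G D v b
    reachable-sound = ball-sound (n G)

    reachable-complete : ∀ {v} → Reach G D v b → b ∈ reachable D v
    reachable-complete {v = v} = reach-closed (reachable-closed v) (centre∈ball (n G))

    component : VSet G → V G → VSet G
    component S = reachable (∁ S)

    centre∈component : ∀ v → v ∈ component S v
    centre∈component v = centre∈ball (n G)

    component-isComponent : ∀ {v} → v ∉ S → Component G S (component S v)
    component-isComponent {S = S} {v} v∉S = (v , centre∈component v) , C⊆∁S , connected , maximal
      where
      C = component S v
      C⊆∁S : C ⊆ ∁ S
      C⊆∁S b∈C with reach-end (reachable-sound b∈C)
      ... | inj₁ refl = x∉p⇒x∈∁p v∉S
      ... | inj₂ b∈∁S = b∈∁S
      connected : Connected G C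
      connected a b a∈C b∈C = reach-restrict (reachable-closed v) a∈C
        (reach-trans (reach-sym (x∉p⇒x∈∁p v∉S) (reachable-sound a∈C)) (reachable-sound b∈C))
      maximal : ∀ a b → a ∈ C → b ∉ S → b ∉ C → adj G a b ≡ false
      maximal a b a∈C b∉S b∉C with adj G a b in e
      ... | false = refl
      ... | true  = contradiction (reachable-closed v a∈C e (x∉p⇒x∈∁p b∉S)) b∉C

    Component⇒≡component : ∀ {C} → Component G S C → b ∈ C → C ≡ component S b
    Component⇒≡component {S = S} {C = C} (_ , C⊆∁S , connected , maximal) b∈C =
      ⊆-antisym (λ a∈C → reachable-complete (reach-mono C⊆∁S (connected _ _ b∈C a∈C)))
                (λ a∈comp → reach-closed closed b∈C (reachable-sound a∈comp))
      where
      closed : StepClosed (∁ S) C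
      closed {x} {y} x∈C e y∈∁S with y ∈? C
      ... | yes y∈C = y∈C
      ... | no  y∉C = case trans (sym e) (maximal x y x∈C (x∈∁p⇒x∉p y∈∁S) y∉C) of λ ()

    component-≡ : ∀ {v} → v ∉ S → b ∈ component S v → component S b ≡ component S v
    component-≡ v∉S b∈ = sym (Component⇒≡component (component-isComponent v∉S) b∈)

    componentList : ∀ S → ∃ (ComponentList G S)
    componentList S = Ds , deduplicate-! _≟ˢ_ candidates , tabulate listed⇒Component , Component⇒listed
      where
      _≟ˢ_ = ≡-dec Boolₚ._≟_
      unremoved = filter (λ v → ¬? (v ∈? S)) (allFin (n G))
      candidates = map (component S) unremoved
      Ds = deduplicate _≟ˢ_ candidates
      listed⇒Component : ∀ {C} → C List.∈ Ds → Component G S C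
      listed⇒Component C∈Ds with ∈-map⁻ (component S) (∈-deduplicate⁻ _≟ˢ_ candidates C∈Ds)
      ... | v , v∈unremoved , refl =
        component-isComponent (proj₂ (∈-filter⁻ (λ v → ¬? (v ∈? S)) {xs = allFin (n G)} v∈unremoved))
      Component⇒listed : ∀ C → Component G S C → C List.∈ Ds
      Component⇒listed C isC@((b , b∈C) , C⊆∁S , _) rewrite Component⇒≡component isC b∈C =
        ∈-deduplicate⁺ _≟ˢ_ (∈-map⁺ (component S) (∈-filter⁺ (λ v → ¬? (v ∈? S)) (∈-allFin b) (x∈∁p⇒x∉p (C⊆∁S b∈C))))

    componentList-≥ : ∀ S (P : VSet G) (g : ∀ x → x ∈ P → V G) → (∀ x x∈P → g x x∈P ∉ S)
                    → (∀ {x y} x∈P y∈P → Reach G (∁ S) (g x x∈P) (g y y∈P) → x ≡ y)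
                    → ∃ λ Ds → ComponentList G S Ds × ∣ P ∣ ≤ length Ds
    componentList-≥ S P g g∉S separated = Ds , isList , injection⇒∣p∣≤m P position position-injective
      where
      Ds = proj₁ (componentList S)
      isList = proj₂ (componentList S)
      listed : ∀ x x∈P → component S (g x x∈P) List.∈ Ds
      listed x x∈P = proj₂ (proj₂ isList) _ (component-isComponent (g∉S x x∈P))
      position : ∀ x → x ∈ P → Fin (length Ds)
      position x x∈P = index (listed x x∈P)
      position-injective : ∀ {x y} x∈P y∈P → position x x∈P ≡ position y y∈P → x ≡ y
      position-injective {x} {y} x∈P y∈P same = separated x∈P y∈P (reachable-sound gy∈component)
        where
        same-component : component S (g x x∈P) ≡ component S (g y y∈P)
        same-component =
          trans (lookup-index (listed x x∈P)) (trans (cong (lookup Ds) same) (sym (lookup-index (listed y y∈P))))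
        gy∈component : g y y∈P ∈ component S (g x x∈P)
        gy∈component = subst (g y y∈P ∈_) (sym same-component) (centre∈component _)

module FloorHalf where

  open import Data.Integer.Base as ℤ using (+_; +<+)
  import Data.Integer.Properties as ℤₚ
  import Data.Integer.DivMod as ℤ
  open import Data.Nat.Base as ℕ using (ℕ; zero; suc; _+_; _*_; s≤s; z≤n)
  import Data.Nat.Properties as ℕₚ
  open import Data.Nat.Coprimality as Coprime using (1-coprimeTo)
  open import Data.Rational.Base as ℚ using (ℚ; mkℚ; _/_; ½; 1ℚ; floor; ↥_; ↧_)
  import Data.Rational.Properties as ℚₚ
  open import Relation.Binary.PropositionalEquality
  open import Relation.Nullary using (contradiction)

  ι : ℕ → ℚ
  ι k = + k / 1

  ι≡mkℚ : ∀ k → ι k ≡ mkℚ (+ k) 0 (Coprime.sym (1-coprimeTo k))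
  ι≡mkℚ k = ℚₚ.normalize-coprime _

  ι-* : ∀ a b → ι a ℚ.* ι b ≡ ι (a * b)
  ι-* a b rewrite ι≡mkℚ a | ι≡mkℚ b = cong (_/ 1) (sym (ℤₚ.pos-* a b))

  ι-cancel-≤ : ∀ {a b} → ι a ℚ.≤ ι b → a ℕ.≤ b
  ι-cancel-≤ {a} {b} a≤b rewrite ι≡mkℚ a | ι≡mkℚ b =
    ℤₚ.drop‿+≤+ (subst₂ ℤ._≤_ (ℤₚ.*-identityʳ (+ a)) (ℤₚ.*-identityʳ (+ b)) (ℚₚ.drop-*≤* a≤b))

  ⌊q⌋≤q : ∀ q {s} → floor q ≡ + s → ι s ℚ.≤ q
  ⌊q⌋≤q q@record{} {s} ⌊q⌋≡s rewrite ι≡mkℚ s =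
    ℚ.*≤* (subst₂ ℤ._≤_ (cong (ℤ._* ↧ q) ⌊q⌋≡s) (sym (ℤₚ.*-identityʳ (↥ q))) (ℤ.[n/d]*d≤n (↥ q) (↧ q)))

  ⌊q⌋≡0⇒q<1 : ∀ q → floor q ≡ + 0 → q ℚ.< 1ℚ
  ⌊q⌋≡0⇒q<1 q@record{} ⌊q⌋≡0 = ℚ.*<* (subst₂ ℤ._<_ ↥q≡ (sym (ℤₚ.*-identityˡ (↧ q))) (+<+ (ℤ.n%d<d (↥ q) (↧ q))))
    where
    open ≡-Reasoning
    ↥q≡ : + (↥ q ℤ.% ↧ q) ≡ ↥ q ℤ.* + 1
    ↥q≡ = begin
      + (↥ q ℤ.% ↧ q)                       ≡⟨ ℤₚ.+-identityʳ _ ⟨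
      + (↥ q ℤ.% ↧ q) ℤ.+ + 0 ℤ.* ↧ q       ≡⟨ cong (λ f → + (↥ q ℤ.% ↧ q) ℤ.+ f ℤ.* ↧ q) ⌊q⌋≡0 ⟨
      + (↥ q ℤ.% ↧ q) ℤ.+ floor q ℤ.* ↧ q   ≡⟨ ℤ.a≡a%n+[a/n]*n (↥ q) (↧ q) ⟨
      ↥ q                                    ≡⟨ ℤₚ.*-identityʳ (↥ q) ⟨
      ↥ q ℤ.* + 1                            ∎

  2≤t⇒1≤⌊t/2⌋ : ∀ {t s} → ι 2 ℚ.≤ t → floor (t ℚ.* ½) ≡ + s → 1 ℕ.≤ s
  2≤t⇒1≤⌊t/2⌋ {s = suc _} _   _       = s≤s z≤n
  2≤t⇒1≤⌊t/2⌋ {s = zero}  2≤t ⌊t/2⌋≡0 =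
    contradiction (ℚₚ.<-≤-trans (⌊q⌋≡0⇒q<1 _ ⌊t/2⌋≡0) (ℚₚ.*-monoʳ-≤-nonNeg ½ 2≤t)) (ℚₚ.<-irrefl refl)

  2⌊t/2⌋≤t : ∀ {t s} → floor (t ℚ.* ½) ≡ + s → ι (s * 2) ℚ.≤ t
  2⌊t/2⌋≤t {t} {s} ⌊t/2⌋≡s = begin
    ι (s * 2)              ≡⟨ ι-* s 2 ⟨
    ι s ℚ.* ι 2            ≤⟨ ℚₚ.*-monoʳ-≤-nonNeg (ι 2) (⌊q⌋≤q (t ℚ.* ½) ⌊t/2⌋≡s) ⟩
    t ℚ.* ½ ℚ.* ι 2        ≡⟨ ℚₚ.*-assoc t ½ (ι 2) ⟩
    t ℚ.* 1ℚ               ≡⟨ ℚₚ.*-identityʳ t ⟩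
    t                      ∎
    where open ℚₚ.≤-Reasoning

  t*k≤m⇒2⌊t/2⌋*k≤m : ∀ {t s k m} → floor (t ℚ.* ½) ≡ + s → t ℚ.* ι k ℚ.≤ ι m → (s + s) * k ℕ.≤ m
  t*k≤m⇒2⌊t/2⌋*k≤m {t} {s} {k} {m} ⌊t/2⌋≡s tk≤m =
    subst (λ a → a * k ℕ.≤ m) (trans (ℕₚ.*-comm s 2) (cong (λ x → s + x) (ℕₚ.+-identityʳ s))) (ι-cancel-≤ (begin
      ι (s * 2 * k)          ≡⟨ ι-* (s * 2) k ⟨
      ι (s * 2) ℚ.* ι k      ≤⟨ ℚₚ.*-monoʳ-≤-nonNeg (ι k) {{ℚₚ.normalize-nonNeg k 1}} (2⌊t/2⌋≤t {t} ⌊t/2⌋≡s) ⟩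
      t ℚ.* ι k              ≤⟨ tk≤m ⟩
      ι m                    ∎))
    where open ℚₚ.≤-Reasoning

module Splitting where

  open Subsets
  open import Defs hiding (sym)
  import Data.Fin.Properties as Finₚ
  open import Data.Fin.Subset
  open import Data.Fin.Subset.Properties
    using (_∈?_; _⊆?_; ⊆-antisym; Empty-unique; x∈p∩q⁺; x∈p∩q⁻; x∈p∪q⁺; x∈p∪q⁻; x∈∁p⇒x∉p; x∉p⇒x∈∁p;
           p⊆q⇒∣p∣≤∣q∣; x∈p∧x≢y⇒x∈p-y; p─q⊆p)
  open import Data.Nat.Base using (ℕ; _+_; _≤_)
  open import Data.Nat.Properties
  open import Data.Product using (∃; _×_; _,_; proj₁; proj₂)
  open import Data.Sum using (inj₁; inj₂; [_,_]′)
  open import Function.Base using (_∘_)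
  open import Relation.Binary.PropositionalEquality
  open import Relation.Nullary using (yes; no)

  module _ (G : Graph) where

    private
      variable
        C X Y₁ Y₂ : VSet G

    complement-partition : X ⊆ C → Nonempty X → ∀ {y} → y ∈ C → y ∉ X → Partition2 G C X (C ∩ ∁ X)
    complement-partition {X = X} {C = C} X⊆C ne {y} y∈C y∉X =
      ne , (y , x∈p∩q⁺ (y∈C , x∉p⇒x∈∁p y∉X)) ,
      Empty-unique (λ (x , x∈) → let x∈X , x∈C∖X = x∈p∩q⁻ X _ x∈ in x∈∁p⇒x∉p (proj₂ (x∈p∩q⁻ C _ x∈C∖X)) x∈X) ,
      ⊆-antisym (λ x∈ → [ X⊆C , proj₁ ∘ x∈p∩q⁻ C _ ]′ (x∈p∪q⁻ X _ x∈)) C⊆X∪C∖X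
      where
      C⊆X∪C∖X : C ⊆ X ∪ C ∩ ∁ X
      C⊆X∪C∖X {x} x∈C with x ∈? X
      ... | yes x∈X = x∈p∪q⁺ (inj₁ x∈X)
      ... | no  x∉X = x∈p∪q⁺ (inj₂ (x∈p∩q⁺ (x∈C , x∉p⇒x∈∁p x∉X)))

    disjoint-partition : Nonempty Y₁ → Nonempty Y₂ → (∀ {y} → y ∈ Y₁ → y ∉ Y₂) → Partition2 G (Y₁ ∪ Y₂) Y₁ Y₂
    disjoint-partition {Y₁ = Y₁} ne₁ ne₂ disjoint =
      ne₁ , ne₂ , Empty-unique (λ (y , y∈) → let y∈Y₁ , y∈Y₂ = x∈p∩q⁻ Y₁ _ y∈ in disjoint y∈Y₁ y∈Y₂) , refl

  module BalancedSplit {G : Graph} (A : V G → VSet G) {C : VSet G} {s : ℕ} {u w : V G}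
    (1≤s : 1 ≤ s) (u∈C : u ∈ C) (w∈C : w ∈ C) (u≢w : u ≢ w) (∣Au∣≤s : ∣ A u ∣ ≤ s) (∣Aw∣≤s : ∣ A w ∣ ≤ s)
    (∣Az∣≤1 : ∀ {z} → z ∈ C → z ≢ u → z ≢ w → ∣ A z ∣ ≤ 1) (2s≤∣A[C]∣ : s + s ≤ ∣ unionOver C A ∣)
    where

    A[C] A[C-w] : VSet G
    A[C]   = unionOver C A
    A[C-w] = unionOver (C - w) A

    s≤∣A[C-w]∣ : s ≤ ∣ A[C-w] ∣
    s≤∣A[C-w]∣ = +-cancelʳ-≤ s s _ (begin
      s + s                    ≤⟨ 2s≤∣A[C]∣ ⟩
      ∣ A[C] ∣                 ≤⟨ p⊆q⇒∣p∣≤∣q∣ A[C]⊆ ⟩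
      ∣ A[C-w] ∪ A w ∣         ≤⟨ ∣p∪q∣≤∣p∣+∣q∣ A[C-w] (A w) ⟩
      ∣ A[C-w] ∣ + ∣ A w ∣     ≤⟨ +-monoʳ-≤ _ ∣Aw∣≤s ⟩
      ∣ A[C-w] ∣ + s           ∎)
      where
      open ≤-Reasoning
      A[C]⊆ : A[C] ⊆ A[C-w] ∪ A w
      A[C]⊆ y∈ with ∈-unionOver⁻ C A y∈
      ... | x , x∈C , y∈Ax with x Finₚ.≟ w
      ...   | yes refl = x∈p∪q⁺ (inj₂ y∈Ax)
      ...   | no  x≢w  = x∈p∪q⁺ (inj₁ (∈-unionOver⁺ (C - w) A (x∈p∧x≢y⇒x∈p-y x∈C x≢w) y∈Ax))

    u∈C-w : u ∈ C - w
    u∈C-w = x∈p∧x≢y⇒x∈p-y u∈C u≢w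

    Y₁-data : ∃ λ Y₁ → A u ⊆ Y₁ × Y₁ ⊆ A[C-w] × ∣ Y₁ ∣ ≡ s
    Y₁-data = subset-of-size-between (A u) A[C-w] (∈-unionOver⁺ (C - w) A u∈C-w) ∣Au∣≤s s≤∣A[C-w]∣

    Y₁ : VSet G
    Y₁ = proj₁ Y₁-data

    ∣Y₁∣≡s : ∣ Y₁ ∣ ≡ s
    ∣Y₁∣≡s = proj₂ (proj₂ (proj₂ Y₁-data))

    X₁ X₂ : VSet G
    X₁ = (C - w) ∩ toSubset (λ x → A x ⊆? Y₁)
    X₂ = C ∩ ∁ X₁

    ∈X₁⁺ : ∀ {x} → x ∈ C - w → A x ⊆ Y₁ → x ∈ X₁
    ∈X₁⁺ x∈C-w Ax⊆Y₁ = x∈p∩q⁺ (x∈C-w , ∈-toSubset⁺ (λ x → A x ⊆? Y₁) Ax⊆Y₁)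

    ∈X₁⁻ : ∀ {x} → x ∈ X₁ → A x ⊆ Y₁
    ∈X₁⁻ x∈X₁ = ∈-toSubset⁻ (λ x → A x ⊆? Y₁) (proj₂ (x∈p∩q⁻ (C - w) _ x∈X₁))

    -- Away from u and w the sets A x have at most one element, so one that meets Y₁ lies inside it.
    Y₁⊆A[X₁] : Y₁ ⊆ unionOver X₁ A
    Y₁⊆A[X₁] {y} y∈Y₁ with ∈-unionOver⁻ (C - w) A (proj₁ (proj₂ (proj₂ Y₁-data)) y∈Y₁)
    ... | x , x∈C-w , y∈Ax = ∈-unionOver⁺ X₁ A (∈X₁⁺ x∈C-w Ax⊆Y₁) y∈Ax
      where
      Ax⊆Y₁ : A x ⊆ Y₁
      Ax⊆Y₁ {y′} y′∈Ax with x Finₚ.≟ u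
      ... | yes refl = proj₁ (proj₂ Y₁-data) y′∈Ax
      ... | no  x≢u  = subst (_∈ Y₁) (∣p∣≤1∧x∈p∧y∈p⇒x≡y (A x) ∣Ax∣≤1 y∈Ax y′∈Ax) y∈Y₁
        where ∣Ax∣≤1 = ∣Az∣≤1 (p─q⊆p C ⁅ w ⁆ x∈C-w) x≢u (x∈p-y⇒x≢y C x∈C-w)

    s≤∣A[C]∖Y₁∣ : s ≤ ∣ A[C] ∩ ∁ Y₁ ∣
    s≤∣A[C]∖Y₁∣ = +-cancelˡ-≤ s s _ (begin
      s + s                               ≤⟨ 2s≤∣A[C]∣ ⟩
      ∣ A[C] ∣                            ≡⟨ ∣p∣≡∣p∩q∣+∣p∩∁q∣ A[C] Y₁ ⟩
      ∣ A[C] ∩ Y₁ ∣ + ∣ A[C] ∩ ∁ Y₁ ∣     ≤⟨ +-monoˡ-≤ _ (p⊆q⇒∣p∣≤∣q∣ (proj₂ ∘ x∈p∩q⁻ A[C] Y₁)) ⟩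
      ∣ Y₁ ∣ + ∣ A[C] ∩ ∁ Y₁ ∣            ≡⟨ cong (_+ ∣ A[C] ∩ ∁ Y₁ ∣) ∣Y₁∣≡s ⟩
      s + ∣ A[C] ∩ ∁ Y₁ ∣                 ∎)
      where open ≤-Reasoning

    Y₂-data : ∃ λ Y₂ → Y₂ ⊆ A[C] ∩ ∁ Y₁ × ∣ Y₂ ∣ ≡ s
    Y₂-data = subset-of-size (A[C] ∩ ∁ Y₁) s≤∣A[C]∖Y₁∣

    Y₂ : VSet G
    Y₂ = proj₁ Y₂-data

    ∣Y₂∣≡s : ∣ Y₂ ∣ ≡ s
    ∣Y₂∣≡s = proj₂ (proj₂ Y₂-data)

    Y₂⊆A[X₂] : Y₂ ⊆ unionOver X₂ A
    Y₂⊆A[X₂] {y} y∈Y₂ with x∈p∩q⁻ A[C] _ (proj₁ (proj₂ Y₂-data) y∈Y₂)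
    ... | y∈A[C] , y∉Y₁ with ∈-unionOver⁻ C A y∈A[C]
    ...   | x , x∈C , y∈Ax =
      ∈-unionOver⁺ X₂ A (x∈p∩q⁺ (x∈C , x∉p⇒x∈∁p λ x∈X₁ → x∈∁p⇒x∉p y∉Y₁ (∈X₁⁻ x∈X₁ y∈Ax))) y∈Ax

    Y₁∩Y₂≡∅ : ∀ {y} → y ∈ Y₁ → y ∉ Y₂
    Y₁∩Y₂≡∅ y∈Y₁ y∈Y₂ = x∈∁p⇒x∉p (proj₂ (x∈p∩q⁻ A[C] _ (proj₁ (proj₂ Y₂-data) y∈Y₂))) y∈Y₁

    X₁⊆C : X₁ ⊆ C
    X₁⊆C = p─q⊆p C ⁅ w ⁆ ∘ proj₁ ∘ x∈p∩q⁻ (C - w) _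

    X-partition : Partition2 G C X₁ X₂
    X-partition = complement-partition G X₁⊆C
      (u , ∈X₁⁺ u∈C-w (proj₁ (proj₂ Y₁-data))) w∈C (λ w∈X₁ → x∈p-y⇒x≢y C (proj₁ (x∈p∩q⁻ (C - w) _ w∈X₁)) refl)

    Y-partition : Partition2 G (Y₁ ∪ Y₂) Y₁ Y₂
    Y-partition = disjoint-partition G (1≤∣p∣⇒Nonempty Y₁ (≤-trans 1≤s (≤-reflexive (sym ∣Y₁∣≡s))))
                                       (1≤∣p∣⇒Nonempty Y₂ (≤-trans 1≤s (≤-reflexive (sym ∣Y₂∣≡s)))) Y₁∩Y₂≡∅

    ∣Y₁∪Y₂∣≡2s : ∣ Y₁ ∪ Y₂ ∣ ≡ s + s
    ∣Y₁∪Y₂∣≡2s = trans (∣p∪q∣≡∣p∣+∣q∣ Y₁ Y₂ Y₁∩Y₂≡∅) (cong₂ _+_ ∣Y₁∣≡s ∣Y₂∣≡s)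

    X₂⊆C : X₂ ⊆ C
    X₂⊆C = proj₁ ∘ x∈p∩q⁻ C _

    Y₁∪Y₂⊆A[C] : Y₁ ∪ Y₂ ⊆ A[C]
    Y₁∪Y₂⊆A[C] y∈ = [ unionOver-mono A X₁⊆C ∘ Y₁⊆A[X₁] , unionOver-mono A X₂⊆C ∘ Y₂⊆A[X₂] ]′ (x∈p∪q⁻ Y₁ Y₂ y∈)

module Matching where

  open Subsets
  open Components
  open Splitting
  open import Defs hiding (sym)
  open import Data.Bool.Base using (true)
  open import Data.Fin.Base using (Fin)
  open import Data.Fin.Properties using (any?) renaming (_≟_ to _≟ᶠ_)
  open import Data.Fin.Subset
  open import Data.Fin.Subset.Properties
    using (_∈?_; nonempty?; ⊆-antisym; Empty-unique; ∣⊥∣≡0; ∈⊤; x∈p∩q⁺; x∈p∩q⁻; x∈p∪q⁺; x∈p∪q⁻; x∈∁p⇒x∉p;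
           x∉p⇒x∈∁p; x∈⁅x⁆; x∈⁅y⁆⇒x≡y; ∣⁅x⁆∣≡1; p⊆q⇒∣p∣≤∣q∣; ∣p∩q∣≤∣p∣)
  open import Data.List.Base using (List; length; lookup)
  import Data.List.Relation.Unary.All as All
  open import Data.List.Membership.Propositional.Properties using (∈-lookup)
  open import Data.Nat.Base using (ℕ; _+_; _*_; _≤_; z≤n; s≤s; >-nonZero)
  open import Data.Nat.Properties
  open import Data.Nat.Tactic.RingSolver using (solve-∀)
  open import Data.Product using (∃; ∃₂; _×_; _,_; proj₁; proj₂)
  open import Data.Sum using (_⊎_; inj₁; inj₂; [_,_]′)
  open import Function.Base using (_∘_; flip)
  open import Relation.Binary.PropositionalEquality
  open import Relation.Nullary using (¬_; yes; no; contradiction)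

  IntegerTough : Graph → ℕ → Set
  IntegerTough G k = ∀ S Ds → Cutset G S → ComponentList G S Ds → k * length Ds ≤ ∣ S ∣

  -- Hall's condition in numbers: a₀, a₁, a₂ count non-centres, first and second centres inside the set,
  -- b₀, b₁, b₂ those outside it in the same components; σ is the size of a cutset, ν the number of S-neighbours.
  hall-arithmetic : ∀ {s a₀ a₁ a₂ b₀ b₁ b₂ ν σ} → 1 ≤ s
                  → (s + s) * (a₁ + b₁) ≤ σ → (s + s) * (a₂ + b₂) ≤ σ → σ ≤ ν + (b₀ + (b₁ + b₂))
                  → s * a₁ + s * a₂ + a₀ ≤ ν + (a₀ + b₀)
  hall-arithmetic {s} {a₀} {a₁} {a₂} {b₀} {b₁} {b₂} {ν} {σ} 1≤s h₁ h₂ σ≤ = begin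
    s * a₁ + s * a₂ + a₀    ≤⟨ +-monoˡ-≤ a₀ (+-cancelʳ-≤ (b₁ + b₂) _ _ core) ⟩
    ν + b₀ + a₀             ≡⟨ shuffle ν b₀ a₀ ⟩
    ν + (a₀ + b₀)           ∎
    where
    open ≤-Reasoning
    shuffle : ∀ x y z → x + y + z ≡ x + (z + y)
    shuffle = solve-∀
    regroup : ∀ s a₁ a₂ b₁ b₂ → s * a₁ + s * a₂ + (s * b₁ + s * b₂) ≡ s * (a₁ + b₁) + s * (a₂ + b₂)
    regroup = solve-∀
    double : ∀ s x y → 2 * (s * x + s * y) ≡ (s + s) * x + (s + s) * y
    double = solve-∀
    half : s * (a₁ + b₁) + s * (a₂ + b₂) ≤ σ
    half = *-cancelˡ-≤ 2 (begin
      2 * (s * (a₁ + b₁) + s * (a₂ + b₂))         ≡⟨ double s (a₁ + b₁) (a₂ + b₂) ⟩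
      (s + s) * (a₁ + b₁) + (s + s) * (a₂ + b₂)   ≤⟨ +-mono-≤ h₁ h₂ ⟩
      σ + σ                                       ≡⟨ cong (σ +_) (+-identityʳ σ) ⟨
      2 * σ                                       ∎)
    core : s * a₁ + s * a₂ + (b₁ + b₂) ≤ ν + b₀ + (b₁ + b₂)
    core = begin
      s * a₁ + s * a₂ + (b₁ + b₂)             ≤⟨ +-monoʳ-≤ (s * a₁ + s * a₂) (+-mono-≤ (m≤n*m b₁ s {{>-nonZero 1≤s}})
                                                                                      (m≤n*m b₂ s {{>-nonZero 1≤s}})) ⟩
      s * a₁ + s * a₂ + (s * b₁ + s * b₂)     ≡⟨ regroup s a₁ a₂ b₁ b₂ ⟩
      s * (a₁ + b₁) + s * (a₂ + b₂)           ≤⟨ half ⟩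
      σ                                       ≤⟨ σ≤ ⟩
      ν + (b₀ + (b₁ + b₂))                    ≡⟨ +-assoc ν b₀ (b₁ + b₂) ⟨
      ν + b₀ + (b₁ + b₂)                      ∎

  module Construction (G : Graph) {s : ℕ} (1≤s : 1 ≤ s) (tough : IntegerTough G (s + s))
                      (S : VSet G) (Ds : List (VSet G)) (isList : ComponentList G S Ds) (2≤w : 2 ≤ length Ds)
    where

    Index : Set
    Index = Fin (length Ds)

    D : Index → VSet G
    D = lookup Ds

    D-isComponent : ∀ i → Component G S (D i)
    D-isComponent i = All.lookup (proj₁ (proj₂ isList)) (∈-lookup i)

    D⊆∁S : ∀ i → D i ⊆ ∁ S
    D⊆∁S i = proj₁ (proj₂ (D-isComponent i))

    D≡component : ∀ {i x} → x ∈ D i → D i ≡ component G S x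
    D≡component {i} = Component⇒≡component G (D-isComponent i)

    D-disjoint : ∀ {i j x} → x ∈ D i → x ∈ D j → i ≡ j
    D-disjoint {i} {j} x∈Dᵢ x∈Dⱼ =
      Unique⇒lookup-injective Ds (proj₁ isList) i j (trans (D≡component x∈Dᵢ) (sym (D≡component x∈Dⱼ)))

    centres : ∀ i → ∃₂ λ u w → u ∈ D i × w ∈ D i × (u ≢ w ⊎ D i ⊆ ⁅ u ⁆)
    centres i = two-elements (D i) (proj₁ (D-isComponent i))

    u w : Index → V G
    u i = proj₁ (centres i)
    w i = proj₁ (proj₂ (centres i))

    u∈D : ∀ i → u i ∈ D i
    u∈D i = proj₁ (proj₂ (proj₂ (centres i)))

    w∈D : ∀ i → w i ∈ D i
    w∈D i = proj₁ (proj₂ (proj₂ (proj₂ (centres i))))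

    module Centres (c : Index → V G) (c∈D : ∀ i → c i ∈ D i) where

      Cs : VSet G
      Cs = toSubset (λ x → any? (λ i → x ≟ᶠ c i))

      ∈Cs⁺ : ∀ i → c i ∈ Cs
      ∈Cs⁺ i = ∈-toSubset⁺ (λ x → any? (λ i → x ≟ᶠ c i)) (i , refl)

      ∈Cs⁻ : ∀ {x} → x ∈ Cs → ∃ λ i → x ≡ c i
      ∈Cs⁻ = ∈-toSubset⁻ (λ x → any? (λ i → x ≟ᶠ c i))

      Cs∩D : ∀ {i x} → x ∈ Cs → x ∈ D i → x ≡ c i
      Cs∩D x∈Cs x∈Dᵢ with ∈Cs⁻ x∈Cs
      ... | j , refl = cong c (D-disjoint (c∈D j) x∈Dᵢ)

      Cs⊆∁S : Cs ⊆ ∁ S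
      Cs⊆∁S x∈Cs with ∈Cs⁻ x∈Cs
      ... | j , refl = D⊆∁S j (c∈D j)

      Cs-unique : ∀ {x x′} → x ∈ Cs → x′ ∈ Cs → x′ ∈ component G S x → x ≡ x′
      Cs-unique x∈Cs x′∈Cs x′∈Cx with ∈Cs⁻ x∈Cs
      ... | i , refl = sym (Cs∩D x′∈Cs (subst (_ ∈_) (sym (D≡component (c∈D i))) x′∈Cx))

      ∣D∩Cs∣ : ∀ i → ∣ D i ∩ Cs ∣ ≡ 1
      ∣D∩Cs∣ i = trans (cong ∣_∣ D∩Cs≡) (∣⁅x⁆∣≡1 (c i))
        where
        D∩Cs≡ : D i ∩ Cs ≡ ⁅ c i ⁆
        D∩Cs≡ = ⊆-antisym
          (λ x∈ → let x∈Dᵢ , x∈Cs = x∈p∩q⁻ (D i) Cs x∈ in subst (_∈ ⁅ c i ⁆) (sym (Cs∩D x∈Cs x∈Dᵢ)) (x∈⁅x⁆ (c i)))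
          (λ x∈⁅cᵢ⁆ → subst (_∈ D i ∩ Cs) (sym (x∈⁅y⁆⇒x≡y (c i) x∈⁅cᵢ⁆)) (x∈p∩q⁺ (c∈D i , ∈Cs⁺ i)))

    open Centres u u∈D public using ()
      renaming (Cs to U₁; Cs∩D to U₁∩D; Cs⊆∁S to U₁⊆∁S; Cs-unique to U₁-unique; ∈Cs⁺ to ∈U₁; ∣D∩Cs∣ to ∣D∩U₁∣)
    open Centres w w∈D public using ()
      renaming (Cs to U₂; Cs∩D to U₂∩D; Cs⊆∁S to U₂⊆∁S; Cs-unique to U₂-unique; ∈Cs⁺ to ∈U₂; ∣D∩Cs∣ to ∣D∩U₂∣)

    NS : VSet G
    NS = ∁ S ∩ ∁ (U₁ ∪ U₂)

    NS⊆∁S : NS ⊆ ∁ S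
    NS⊆∁S = proj₁ ∘ x∈p∩q⁻ (∁ S) _

    ∈NS⁺ : ∀ {x} → x ∉ S → x ∉ U₁ → x ∉ U₂ → x ∈ NS
    ∈NS⁺ x∉S x∉U₁ x∉U₂ = x∈p∩q⁺ (x∉p⇒x∈∁p x∉S , x∉p⇒x∈∁p λ x∈U₁∪U₂ → [ x∉U₁ , x∉U₂ ]′ (x∈p∪q⁻ U₁ U₂ x∈U₁∪U₂))

    ∈NS⁻ : ∀ {x} → x ∈ NS → x ∉ U₁ × x ∉ U₂
    ∈NS⁻ x∈NS = (λ x∈U₁ → x∉U₁∪U₂ (x∈p∪q⁺ (inj₁ x∈U₁))) , (λ x∈U₂ → x∉U₁∪U₂ (x∈p∪q⁺ (inj₂ x∈U₂)))
      where x∉U₁∪U₂ = x∈∁p⇒x∉p (proj₂ (x∈p∩q⁻ (∁ S) _ x∈NS))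

    ∉S⇒∈NS∪U₁∪U₂ : ∀ {x} → x ∉ S → x ∈ (NS ∪ U₁) ∪ U₂
    ∉S⇒∈NS∪U₁∪U₂ {x} x∉S with x ∈? U₁ | x ∈? U₂
    ... | yes x∈U₁ | _        = x∈p∪q⁺ (inj₁ (x∈p∪q⁺ (inj₂ x∈U₁)))
    ... | no  _    | yes x∈U₂ = x∈p∪q⁺ (inj₂ x∈U₂)
    ... | no  x∉U₁ | no  x∉U₂ = x∈p∪q⁺ (inj₁ (x∈p∪q⁺ (inj₁ (∈NS⁺ x∉S x∉U₁ x∉U₂))))

    -- A single-vertex component has u = w, so its vertex carries demand 2s.
    cap : V G → ℕ
    cap x = s * indicator U₁ x + s * indicator U₂ x + indicator NS x

    sumOver-cap : ∀ Q → sumOver Q cap ≡ s * ∣ Q ∩ U₁ ∣ + s * ∣ Q ∩ U₂ ∣ + ∣ Q ∩ NS ∣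
    sumOver-cap Q = trans (sumOver-+ Q _ (indicator NS))
      (cong₂ _+_ (trans (sumOver-+ Q _ _) (cong₂ _+_ (scaled U₁) (scaled U₂))) (sumOver-indicator Q NS))
      where
      scaled : ∀ U → sumOver Q (λ x → s * indicator U x) ≡ s * ∣ Q ∩ U ∣
      scaled U = trans (sumOver-* Q s (indicator U)) (cong (s *_) (sumOver-indicator Q U))

    -- Non-centres of a vertex's own component act as placeholders for the neighbours in S it need not use.
    nbhd : V G → VSet G
    nbhd x = S ∩ neighbours G x ∪ NS ∩ component G S x

    some-centre-outside : ∀ {x} → x ∉ S → ∃ λ j → u j ∉ component G S x
    some-centre-outside {x} x∉S with two-indices 2≤w
    ... | i , j , i≢j with u i ∈? component G S x | u j ∈? component G S x
    ...   | no  uᵢ∉ | _       = i , uᵢ∉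
    ...   | yes _   | no  uⱼ∉ = j , uⱼ∉
    ...   | yes uᵢ∈ | yes uⱼ∈ = contradiction (D-disjoint (u∈D j) uⱼ∈Dᵢ) (i≢j ∘ sym)
      where
      uⱼ∈Dᵢ : u j ∈ D i
      uⱼ∈Dᵢ = subst (u j ∈_) (trans (sym (component-≡ G x∉S uᵢ∈)) (sym (D≡component (u∈D i)))) uⱼ∈

    module ConditionFor (Q : VSet G) where

      X C NX S* : VSet G
      X  = Q ∩ ∁ S
      C  = unionOver X (component G S)
      NX = S ∩ unionOver X (neighbours G)
      S* = NX ∪ C ∩ ∁ Q

      ∈X⇒∉S : ∀ {x} → x ∈ X → x ∉ S
      ∈X⇒∉S = x∈∁p⇒x∉p ∘ proj₂ ∘ x∈p∩q⁻ Q _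

      ∈X⇒∉S* : ∀ {x} → x ∈ X → x ∉ S*
      ∈X⇒∉S* x∈X x∈S* with x∈p∪q⁻ NX _ x∈S*
      ... | inj₁ x∈NX  = ∈X⇒∉S x∈X (proj₁ (x∈p∩q⁻ S _ x∈NX))
      ... | inj₂ x∈C∖Q = x∈∁p⇒x∉p (proj₂ (x∈p∩q⁻ C _ x∈C∖Q)) (proj₁ (x∈p∩q⁻ Q _ x∈X))

      confined : ∀ {x z} → x ∈ X → Reach G (∁ S*) x z → z ∈ X ∩ component G S x
      confined {x} x∈X = reach-closed G closed (x∈p∩q⁺ (x∈X , centre∈component G x))
        where
        closed : StepClosed G (∁ S*) (X ∩ component G S x)
        closed {a} {z} a∈ e z∉S* with x∈p∩q⁻ X _ a∈ | z ∈? S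
        ... | a∈X , _    | yes z∈S = contradiction
          (x∈p∪q⁺ (inj₁ (x∈p∩q⁺ (z∈S , ∈-unionOver⁺ X (neighbours G) a∈X (∈-neighbours⁺ G e))))) (x∈∁p⇒x∉p z∉S*)
        ... | _   , a∈Cx | no  z∉S with z ∈? Q | reachable-closed G x a∈Cx e (x∉p⇒x∈∁p z∉S)
        ...   | yes z∈Q | z∈Cx = x∈p∩q⁺ (x∈p∩q⁺ (z∈Q , x∉p⇒x∈∁p z∉S) , z∈Cx)
        ...   | no  z∉Q | z∈Cx = contradiction
          (x∈p∪q⁺ (inj₂ (x∈p∩q⁺ (∈-unionOver⁺ X (component G S) x∈X z∈Cx , x∉p⇒x∈∁p z∉Q)))) (x∈∁p⇒x∉p z∉S*)

      separated : ∀ {x v} → x ∈ X → v ∉ component G S x → ¬ Reach G (∁ S*) x v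
      separated x∈X v∉Cx x↝v = v∉Cx (proj₂ (x∈p∩q⁻ X _ (confined x∈X x↝v)))

      S*-cutset : ∀ {x₀} → x₀ ∈ X → Cutset G S*
      S*-cutset {x₀} x₀∈X with some-centre-outside (∈X⇒∉S x₀∈X)
      ... | j , uⱼ∉Cx₀ with u j ∈? S*
      ...   | no  uⱼ∉S* = x₀ , u j , ∈X⇒∉S* x₀∈X , uⱼ∉S* , separated x₀∈X uⱼ∉Cx₀
      ...   | yes uⱼ∈S* with x∈p∪q⁻ NX _ uⱼ∈S*
      ...     | inj₁ uⱼ∈NX  = contradiction (proj₁ (x∈p∩q⁻ S _ uⱼ∈NX)) (x∈∁p⇒x∉p (D⊆∁S j (u∈D j)))
      ...     | inj₂ uⱼ∈C∖Q with ∈-unionOver⁻ X (component G S) (proj₁ (x∈p∩q⁻ C _ uⱼ∈C∖Q))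
      ...       | x₁ , x₁∈X , uⱼ∈Cx₁ = x₀ , x₁ , ∈X⇒∉S* x₀∈X , ∈X⇒∉S* x₁∈X , separated x₀∈X x₁∉Cx₀
        where
        x₁∉Cx₀ : x₁ ∉ component G S x₀
        x₁∉Cx₀ x₁∈Cx₀ = uⱼ∉Cx₀ (subst (u j ∈_) (component-≡ G (∈X⇒∉S x₀∈X) x₁∈Cx₀) uⱼ∈Cx₁)

      representative : ∀ {y} → y ∈ C → ∃ λ x → x ∈ X × y ∈ component G S x
      representative = ∈-unionOver⁻ X (component G S)

      rep : ∀ y → y ∈ C → V G
      rep y y∈C = proj₁ (representative y∈C)

      rep∈X : ∀ {y} (y∈C : y ∈ C) → rep y y∈C ∈ X
      rep∈X y∈C = proj₁ (proj₂ (representative y∈C))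

      component-rep : ∀ {y} (y∈C : y ∈ C) → component G S y ≡ component G S (rep y y∈C)
      component-rep y∈C = component-≡ G (∈X⇒∉S (rep∈X y∈C)) (proj₂ (proj₂ (representative y∈C)))

      rep-separated : ∀ {y y′} y∈C y′∈C → Reach G (∁ S*) (rep y y∈C) (rep y′ y′∈C) → component G S y′ ≡ component G S y
      rep-separated y∈C y′∈C r = trans (component-rep y′∈C)
        (trans (component-≡ G (∈X⇒∉S (rep∈X y∈C)) (proj₂ (x∈p∩q⁻ X _ (confined (rep∈X y∈C) r)))) (sym (component-rep y∈C)))

      -- Every component met by X yields a component of G - S* through its representative in X.
      tough-on : ∀ U → (∀ {y y′} → y ∈ U → y′ ∈ U → y′ ∈ component G S y → y ≡ y′) → (s + s) * ∣ C ∩ U ∣ ≤ ∣ S* ∣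
      tough-on U unique with nonempty? X
      ... | no  X≡∅ = ≤-trans (≤-reflexive (trans (cong ((s + s) *_) ∣C∩U∣≡0) (*-zeroʳ (s + s)))) z≤n
        where
        ∣C∩U∣≡0 : ∣ C ∩ U ∣ ≡ 0
        ∣C∩U∣≡0 = trans (cong ∣_∣ (Empty-unique λ (y , y∈) → X≡∅ (_ , rep∈X (proj₁ (x∈p∩q⁻ C U y∈))))) (∣⊥∣≡0 (n G))
      ... | yes (x₀ , x₀∈X) =
        let Ds′ , isList′ , ∣C∩U∣≤w′ = componentList-≥ G S* (C ∩ U) rep′ (λ _ → ∈X⇒∉S* ∘ rep∈X ∘ in-C) separated′
        in ≤-trans (*-monoʳ-≤ (s + s) ∣C∩U∣≤w′) (tough S* Ds′ (S*-cutset x₀∈X) isList′)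
        where
        in-C : ∀ {y} → y ∈ C ∩ U → y ∈ C
        in-C = proj₁ ∘ x∈p∩q⁻ C U
        rep′ : ∀ y → y ∈ C ∩ U → V G
        rep′ y = rep y ∘ in-C
        separated′ : ∀ {y y′} y∈ y′∈ → Reach G (∁ S*) (rep′ y y∈) (rep′ y′ y′∈) → y ≡ y′
        separated′ {y} {y′} y∈ y′∈ r = unique (proj₂ (x∈p∩q⁻ C U y∈)) (proj₂ (x∈p∩q⁻ C U y′∈))
          (subst (y′ ∈_) (rep-separated (in-C y∈) (in-C y′∈) r) (centre∈component G y′))

      #in #out : VSet G → ℕ
      #in  U = ∣ (C ∩ U) ∩ Q ∣
      #out U = ∣ (C ∩ U) ∩ ∁ Q ∣

      ∣Q∩U∣≤#in : ∀ U → U ⊆ ∁ S → ∣ Q ∩ U ∣ ≤ #in U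
      ∣Q∩U∣≤#in U U⊆∁S = p⊆q⇒∣p∣≤∣q∣ λ {x} x∈ →
        let x∈Q , x∈U = x∈p∩q⁻ Q U x∈
        in x∈p∩q⁺ (x∈p∩q⁺ (∈-unionOver⁺ X (component G S) (x∈p∩q⁺ (x∈Q , U⊆∁S x∈U)) (centre∈component G x) , x∈U) , x∈Q)

      tough-split : ∀ U → (∀ {y y′} → y ∈ U → y′ ∈ U → y′ ∈ component G S y → y ≡ y′)
                  → (s + s) * (#in U + #out U) ≤ ∣ S* ∣
      tough-split U unique = subst (λ k → (s + s) * k ≤ ∣ S* ∣) (∣p∣≡∣p∩q∣+∣p∩∁q∣ (C ∩ U) Q) (tough-on U unique)

      ∣S*∣≤ : ∣ S* ∣ ≤ ∣ NX ∣ + (#out NS + (#out U₁ + #out U₂))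
      ∣S*∣≤ = begin
        ∣ S* ∣                                                             ≤⟨ ∣p∪q∣≤∣p∣+∣q∣ NX (C ∩ ∁ Q) ⟩
        ∣ NX ∣ + ∣ C ∩ ∁ Q ∣                                              ≤⟨ +-monoʳ-≤ ∣ NX ∣ (p⊆q⇒∣p∣≤∣q∣ C∖Q⊆) ⟩
        ∣ NX ∣ + ∣ (C ∩ NS) ∩ ∁ Q ∪ (C ∩ U₁) ∩ ∁ Q ∪ (C ∩ U₂) ∩ ∁ Q ∣     ≤⟨ +-monoʳ-≤ ∣ NX ∣ (≤-trans
             (∣p∪q∣≤∣p∣+∣q∣ ((C ∩ NS) ∩ ∁ Q) _) (+-monoʳ-≤ (#out NS) (∣p∪q∣≤∣p∣+∣q∣ ((C ∩ U₁) ∩ ∁ Q) _))) ⟩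
        ∣ NX ∣ + (#out NS + (#out U₁ + #out U₂))                          ∎
        where
        open ≤-Reasoning
        C⊆∁S : C ⊆ ∁ S
        C⊆∁S x∈C = let x₀ , x₀∈X , x∈Cx₀ = representative x∈C in proj₁ (proj₂ (component-isComponent G (∈X⇒∉S x₀∈X))) x∈Cx₀
        C∖Q⊆ : C ∩ ∁ Q ⊆ (C ∩ NS) ∩ ∁ Q ∪ (C ∩ U₁) ∩ ∁ Q ∪ (C ∩ U₂) ∩ ∁ Q
        C∖Q⊆ {x} x∈ with x∈p∩q⁻ C _ x∈
        ... | x∈C , x∉Q with x∈p∪q⁻ (NS ∪ U₁) U₂ (∉S⇒∈NS∪U₁∪U₂ (x∈∁p⇒x∉p (C⊆∁S x∈C)))
        ...   | inj₂ x∈U₂ = x∈p∪q⁺ (inj₂ (x∈p∪q⁺ (inj₂ (x∈p∩q⁺ (x∈p∩q⁺ (x∈C , x∈U₂) , x∉Q)))))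
        ...   | inj₁ x∈NS∪U₁ with x∈p∪q⁻ NS U₁ x∈NS∪U₁
        ...     | inj₁ x∈NS = x∈p∪q⁺ (inj₁ (x∈p∩q⁺ (x∈p∩q⁺ (x∈C , x∈NS) , x∉Q)))
        ...     | inj₂ x∈U₁ = x∈p∪q⁺ (inj₂ (x∈p∪q⁺ (inj₁ (x∈p∩q⁺ (x∈p∩q⁺ (x∈C , x∈U₁) , x∉Q)))))

      NX∪NS⊆ : NX ∪ C ∩ NS ⊆ unionOver Q nbhd ∩ ⊤
      NX∪NS⊆ {y} y∈ = x∈p∩q⁺ (served (x∈p∪q⁻ NX _ y∈) , ∈⊤)
        where
        served : y ∈ NX ⊎ y ∈ C ∩ NS → y ∈ unionOver Q nbhd
        served (inj₁ y∈NX) with x∈p∩q⁻ S _ y∈NX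
        ... | y∈S , y∈N[X] with ∈-unionOver⁻ X (neighbours G) y∈N[X]
        ...   | x , x∈X , y∈Nx = ∈-unionOver⁺ Q nbhd (proj₁ (x∈p∩q⁻ Q _ x∈X)) (x∈p∪q⁺ (inj₁ (x∈p∩q⁺ (y∈S , y∈Nx))))
        served (inj₂ y∈C∩NS) with x∈p∩q⁻ C NS y∈C∩NS
        ... | y∈C , y∈NS with representative y∈C
        ...   | x , x∈X , y∈Cx = ∈-unionOver⁺ Q nbhd (proj₁ (x∈p∩q⁻ Q _ x∈X)) (x∈p∪q⁺ (inj₂ (x∈p∩q⁺ (y∈NS , y∈Cx))))

      condition : sumOver Q cap ≤ ∣ unionOver Q nbhd ∩ ⊤ ∣
      condition = begin
        sumOver Q cap                                  ≡⟨ sumOver-cap Q ⟩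
        s * ∣ Q ∩ U₁ ∣ + s * ∣ Q ∩ U₂ ∣ + ∣ Q ∩ NS ∣   ≤⟨ +-mono-≤ (+-mono-≤ (*-monoʳ-≤ s (∣Q∩U∣≤#in U₁ U₁⊆∁S))
                                                                         (*-monoʳ-≤ s (∣Q∩U∣≤#in U₂ U₂⊆∁S)))
                                                               (∣Q∩U∣≤#in NS NS⊆∁S) ⟩
        s * #in U₁ + s * #in U₂ + #in NS               ≤⟨ hall-arithmetic {b₀ = #out NS} {ν = ∣ NX ∣} 1≤s
                                                            (tough-split U₁ U₁-unique) (tough-split U₂ U₂-unique) ∣S*∣≤ ⟩
        ∣ NX ∣ + (#in NS + #out NS)                    ≡⟨ cong (∣ NX ∣ +_) (∣p∣≡∣p∩q∣+∣p∩∁q∣ (C ∩ NS) Q) ⟨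
        ∣ NX ∣ + ∣ C ∩ NS ∣                            ≡⟨ ∣p∪q∣≡∣p∣+∣q∣ NX (C ∩ NS) NX-apart ⟨
        ∣ NX ∪ C ∩ NS ∣                                ≤⟨ p⊆q⇒∣p∣≤∣q∣ NX∪NS⊆ ⟩
        ∣ unionOver Q nbhd ∩ ⊤ ∣                       ∎
        where
        open ≤-Reasoning
        NX-apart : ∀ {y} → y ∈ NX → y ∉ C ∩ NS
        NX-apart y∈NX y∈C∩NS = x∈∁p⇒x∉p (NS⊆∁S (proj₂ (x∈p∩q⁻ C NS y∈C∩NS))) (proj₁ (x∈p∩q⁻ S _ y∈NX))

    open CapacitatedHall nbhd using (Assignment; hall)

    -- Opaque: unfolding the Hall recursion while checking the rest is prohibitively expensive.
    opaque
      assignment : Assignment cap ⊤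
      assignment = hall ConditionFor.condition

    open Assignment assignment

    Ar : V G → VSet G
    Ar x = assigned x ∩ S

    Ar⊆S∩N : ∀ {x y} → y ∈ Ar x → y ∈ S × adj G x y ≡ true
    Ar⊆S∩N {x} {y} y∈ with x∈p∩q⁻ (assigned x) S y∈
    ... | y∈Ax , y∈S with x∈p∪q⁻ (S ∩ neighbours G x) _ (assigned⊆N x y∈Ax)
    ...   | inj₁ y∈S∩Nx  = y∈S , ∈-neighbours⁻ G (proj₂ (x∈p∩q⁻ S _ y∈S∩Nx))
    ...   | inj₂ y∈NS∩Cx = contradiction y∈S (x∈∁p⇒x∉p (NS⊆∁S (proj₁ (x∈p∩q⁻ NS _ y∈NS∩Cx))))

    Ar-disjoint : ∀ {x x′ y} → y ∈ Ar x → y ∈ Ar x′ → x ≡ x′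
    Ar-disjoint {x} {x′} y∈ y∈′ = assigned-disjoint (proj₁ (x∈p∩q⁻ (assigned x) S y∈)) (proj₁ (x∈p∩q⁻ (assigned x′) S y∈′))

    NbhdSub-Ar : ∀ {X Y} → X ⊆ ∁ S → Y ⊆ unionOver X Ar → NbhdSub G Y X
    NbhdSub-Ar {X} X⊆∁S Y⊆ y y∈Y with ∈-unionOver⁻ X Ar (Y⊆ y∈Y)
    ... | x , x∈X , y∈Arx with Ar⊆S∩N y∈Arx
    ...   | y∈S , e = (λ y∈X → x∈∁p⇒x∉p (X⊆∁S y∈X) y∈S) , x , x∈X , e

    unionOver-Ar⊆S : ∀ X → unionOver X Ar ⊆ S
    unionOver-Ar⊆S X y∈ = let _ , _ , y∈Arx = ∈-unionOver⁻ X Ar y∈ in proj₁ (Ar⊆S∩N y∈Arx)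

    module OfComponent (i : Index) where

      ∣Ar∣≤cap : ∀ x → ∣ Ar x ∣ ≤ cap x
      ∣Ar∣≤cap x = ≤-trans (∣p∩q∣≤∣p∣ (assigned x) S) (≤-reflexive (∣assigned∣ x))

      -- Placeholders lie in D i ∩ NS, so at least 2s units of the demand of D i are served in S.
      2s≤∣Ar[D]∣ : s + s ≤ ∣ unionOver (D i) Ar ∣
      2s≤∣Ar[D]∣ = +-cancelʳ-≤ ∣ D i ∩ NS ∣ _ _ (begin
        s + s + ∣ D i ∩ NS ∣                               ≡⟨ cong₂ (λ a b → a + b + ∣ D i ∩ NS ∣) (s* (∣D∩U₁∣ i)) (s* (∣D∩U₂∣ i)) ⟨
        s * ∣ D i ∩ U₁ ∣ + s * ∣ D i ∩ U₂ ∣ + ∣ D i ∩ NS ∣  ≡⟨ sumOver-cap (D i) ⟨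
        sumOver (D i) cap                                   ≡⟨ sumOver-cong (D i) (λ {x} _ → sym (∣assigned∣ x)) ⟩
        sumOver (D i) (∣_∣ ∘ assigned)                      ≡⟨ ∣unionOver∣≡sumOver (D i) assigned assigned-disjoint ⟨
        ∣ unionOver (D i) assigned ∣                        ≤⟨ p⊆q⇒∣p∣≤∣q∣ assigned[D]⊆ ⟩
        ∣ unionOver (D i) Ar ∪ D i ∩ NS ∣                   ≤⟨ ∣p∪q∣≤∣p∣+∣q∣ (unionOver (D i) Ar) _ ⟩
        ∣ unionOver (D i) Ar ∣ + ∣ D i ∩ NS ∣               ∎)
        where
        open ≤-Reasoning
        s* : ∀ {a} → a ≡ 1 → s * a ≡ s
        s* a≡1 = trans (cong (s *_) a≡1) (*-identityʳ s)
        assigned[D]⊆ : unionOver (D i) assigned ⊆ unionOver (D i) Ar ∪ D i ∩ NS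
        assigned[D]⊆ {y} y∈ with ∈-unionOver⁻ (D i) assigned y∈
        ... | x , x∈Dᵢ , y∈Ax with y ∈? S
        ...   | yes y∈S = x∈p∪q⁺ (inj₁ (∈-unionOver⁺ (D i) Ar x∈Dᵢ (x∈p∩q⁺ (y∈Ax , y∈S))))
        ...   | no  y∉S with x∈p∪q⁻ (S ∩ neighbours G x) _ (assigned⊆N x y∈Ax)
        ...     | inj₁ y∈S∩Nx  = contradiction (proj₁ (x∈p∩q⁻ S _ y∈S∩Nx)) y∉S
        ...     | inj₂ y∈NS∩Cx = let y∈NS , y∈Cx = x∈p∩q⁻ NS _ y∈NS∩Cx
                                 in x∈p∪q⁺ (inj₂ (x∈p∩q⁺ (subst (y ∈_) (sym (D≡component x∈Dᵢ)) y∈Cx , y∈NS)))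

      cap-u : u i ≢ w i → cap (u i) ≡ s
      cap-u uᵢ≢wᵢ rewrite indicator-∈ (∈U₁ i) | indicator-∉ (uᵢ≢wᵢ ∘ flip U₂∩D (u∈D i))
                        | indicator-∉ (λ uᵢ∈NS → proj₁ (∈NS⁻ uᵢ∈NS) (∈U₁ i))
        = trans (+-identityʳ _) (trans (cong₂ _+_ (*-identityʳ s) (*-zeroʳ s)) (+-identityʳ s))

      cap-w : u i ≢ w i → cap (w i) ≡ s
      cap-w uᵢ≢wᵢ rewrite indicator-∉ (uᵢ≢wᵢ ∘ sym ∘ flip U₁∩D (w∈D i)) | indicator-∈ (∈U₂ i)
                        | indicator-∉ (λ wᵢ∈NS → proj₂ (∈NS⁻ wᵢ∈NS) (∈U₂ i))
        = trans (+-identityʳ _) (cong₂ _+_ (*-zeroʳ s) (*-identityʳ s))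

      cap-other : ∀ {z} → z ∈ D i → z ≢ u i → z ≢ w i → cap z ≡ 1
      cap-other z∈Dᵢ z≢uᵢ z≢wᵢ
        rewrite indicator-∉ (z≢uᵢ ∘ flip U₁∩D z∈Dᵢ) | indicator-∉ (z≢wᵢ ∘ flip U₂∩D z∈Dᵢ)
              | indicator-∈ (∈NS⁺ (x∈∁p⇒x∉p (D⊆∁S i z∈Dᵢ)) (z≢uᵢ ∘ flip U₁∩D z∈Dᵢ) (z≢wᵢ ∘ flip U₂∩D z∈Dᵢ))
        = cong (_+ 1) (cong₂ _+_ (*-zeroʳ s) (*-zeroʳ s))

      Structure : Set
      Structure = ∃ λ Y → Y ⊆ unionOver (D i) Ar × GenK G s (D i) Y

      single-vertex : D i ⊆ ⁅ u i ⁆ → Structure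
      single-vertex Dᵢ⊆⁅uᵢ⁆ =
        let Y , Y⊆ , ∣Y∣≡2s = subset-of-size (unionOver (D i) Ar) 2s≤∣Ar[D]∣
        in Y , Y⊆ , proj₁ (D-isComponent i) , NbhdSub-Ar (D⊆∁S i) Y⊆ , ∣Y∣≡2s , λ 2≤∣Dᵢ∣ →
             contradiction (≤-trans 2≤∣Dᵢ∣ (≤-trans (p⊆q⇒∣p∣≤∣q∣ Dᵢ⊆⁅uᵢ⁆) (≤-reflexive (∣⁅x⁆∣≡1 (u i))))) λ { (s≤s ()) }

      two-centres : u i ≢ w i → Structure
      two-centres uᵢ≢wᵢ =
        Y₁ ∪ Y₂ , Y₁∪Y₂⊆A[C] , proj₁ (D-isComponent i) , NbhdSub-Ar (D⊆∁S i) Y₁∪Y₂⊆A[C] , ∣Y₁∪Y₂∣≡2s ,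
        λ _ → X₁ , X₂ , Y₁ , Y₂ , X-partition , Y-partition ,
              NbhdSub-Ar (D⊆∁S i ∘ X₁⊆C) Y₁⊆A[X₁] , x∈p∪q⁺ ∘ inj₁ , ∣Y₁∣≡s ,
              NbhdSub-Ar (D⊆∁S i ∘ X₂⊆C) Y₂⊆A[X₂] , x∈p∪q⁺ ∘ inj₂ , ∣Y₂∣≡s
        where
        open BalancedSplit {G = G} Ar 1≤s (u∈D i) (w∈D i) uᵢ≢wᵢ
               (≤-trans (∣Ar∣≤cap (u i)) (≤-reflexive (cap-u uᵢ≢wᵢ))) (≤-trans (∣Ar∣≤cap (w i)) (≤-reflexive (cap-w uᵢ≢wᵢ)))
               (λ z∈Dᵢ z≢uᵢ z≢wᵢ → ≤-trans (∣Ar∣≤cap _) (≤-reflexive (cap-other z∈Dᵢ z≢uᵢ z≢wᵢ))) 2s≤∣Ar[D]∣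

      structure : Structure
      structure with proj₂ (proj₂ (proj₂ (proj₂ (centres i))))
      ... | inj₁ uᵢ≢wᵢ   = two-centres uᵢ≢wᵢ
      ... | inj₂ Dᵢ⊆⁅uᵢ⁆ = single-vertex Dᵢ⊆⁅uᵢ⁆

    matching : GenKMatching G s S Ds
    matching = Y , (λ i → NbhdSub-Ar (D⊆∁S i) (Y⊆ i) , unionOver-Ar⊆S (D i) ∘ Y⊆ i , Y-genK i) , Y-disjoint
      where
      Y : Index → VSet G
      Y i = proj₁ (OfComponent.structure i)
      Y⊆ : ∀ i → Y i ⊆ unionOver (D i) Ar
      Y⊆ i = proj₁ (proj₂ (OfComponent.structure i))
      Y-genK : ∀ i → GenK G s (D i) (Y i)
      Y-genK i = proj₂ (proj₂ (OfComponent.structure i))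
      Y-disjoint : ∀ i j → i ≢ j → Y i ∩ Y j ≡ ⊥
      Y-disjoint i j i≢j = Empty-unique λ (y , y∈) →
        let y∈Yᵢ , y∈Yⱼ = x∈p∩q⁻ (Y i) (Y j) y∈
            x , x∈Dᵢ , y∈Arx = ∈-unionOver⁻ (D i) Ar (Y⊆ i y∈Yᵢ)
            x′ , x′∈Dⱼ , y∈Arx′ = ∈-unionOver⁻ (D j) Ar (Y⊆ j y∈Yⱼ)
        in i≢j (D-disjoint x∈Dᵢ (subst (_∈ D j) (sym (Ar-disjoint y∈Arx y∈Arx′)) x′∈Dⱼ))

open import Defs
open import Data.Nat using (ℕ; _≤_)
open import Data.Integer using (+_)
open import Data.Rational using (ℚ; _/_; _*_; ½; floor)
import Data.Rational as ℚ
open import Data.List using (List; length)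
open import Relation.Binary.PropositionalEquality using (_≡_)
open import Data.Nat using (s≤s; z≤n; _+_)
open import Data.Nat.Properties using (≤-trans)
open import Data.Fin.Subset using (∣_∣)
open FloorHalf using (2≤t⇒1≤⌊t/2⌋; t*k≤m⇒2⌊t/2⌋*k≤m)
open Matching using (IntegerTough; module Construction)

Tough⇒IntegerTough : ∀ {G t s} → floor (t * ½) ≡ + s → Tough G t → IntegerTough G (s + s)
Tough⇒IntegerTough {G} {t} {s} ⌊t/2⌋≡s tough S Ds cut isList =
  t*k≤m⇒2⌊t/2⌋*k≤m {t} {s} {length Ds} {∣ S ∣} ⌊t/2⌋≡s (tough S Ds cut isList)

lemma2p3 : (t : ℚ) → (+ 2 / 1) ℚ.≤ t → (G : Graph) → Tough G t → Free G P3∪3P1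
    → (s : ℕ) → floor (t * ½) ≡ + s
    → (S : VSet G) → Cutset G S → (Ds : List (VSet G)) → ComponentList G S Ds
    → 5 ≤ length Ds → GenKMatching G s S Ds
lemma2p3 t 2≤t G tough _ s ⌊t/2⌋≡s S _ Ds isList 5≤w =
  Construction.matching G (2≤t⇒1≤⌊t/2⌋ 2≤t ⌊t/2⌋≡s) (Tough⇒IntegerTough {G} {t} ⌊t/2⌋≡s tough) S Ds isList
                        (≤-trans (s≤s (s≤s z≤n)) 5≤w)
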